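{- Let $p$ be a prime with $p\equiv 1\pmod 4$. For $k=1,2,\ldots$ define $a_k(x)=\sum_{m=0}^{k}\left(\frac{k-m}{p}\right)x^m$ and let $H_p(x)=\det\big[a_{i+j-1}(x)\big]_{1\le i,j\le p}$. Then $x^2-1$ divides $H_p(x)$.
   Context: For a prime $p$, the Legendre symbol $\left(\frac{a}{p}\right)$ is $0$ if $p\mid a$, $1$ if $a$ is a nonzero quadratic residue mod $p$, and $-1$ if $a$ is a quadratic nonresidue mod $p$. -}

module Defs where

open import Data.Nat as ℕ using (ℕ; zero; suc; _∸_; _%_)
open import Data.Nat.Divisibility using (_∣?_)
open import Data.Integer as ℤ using (ℤ; +_; -_)
open import Data.Fin using (Fin; toℕ; punchIn) renaming (zero to fz; suc to fs)
open import Data.List using (List; []; _∷_; map; foldr; upTo; allFin)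
open import Data.List.Relation.Unary.Any using (any?)
open import Data.Product using (Σ)
open import Relation.Nullary using (yes; no)
open import Relation.Binary.PropositionalEquality using (_≡_)

-- Legendre symbol (a / p) for a natural number a.
-- legendre p a = 0 if p ∣ a; 1 if some x ∈ {0,…,p-1} has x² ≡ a (mod p); -1 otherwise.
-- (Value at p = 0 is junk; only used for prime p.)
legendre : ℕ → ℕ → ℤ
legendre zero    a = + 0
legendre (suc q) a with suc q ∣? a
... | yes _ = + 0
... | no  _ with any? (λ x → ((x ℕ.* x) % suc q) ℕ.≟ (a % suc q)) (upTo (suc q))
...   | yes _ = + 1
...   | no  _ = - (+ 1)

-- Polynomials over ℤ as coefficient lists, lowest degree first.
Poly : Set
Poly = List ℤ

coeff : Poly → ℕ → ℤ
coeff []       _       = + 0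
coeff (c ∷ _)  zero    = c
coeff (_ ∷ cs) (suc n) = coeff cs n

_≈P_ : Poly → Poly → Set
f ≈P g = ∀ n → coeff f n ≡ coeff g n

_+P_ : Poly → Poly → Poly
[]       +P g        = g
(a ∷ f)  +P []       = a ∷ f
(a ∷ f)  +P (b ∷ g)  = (a ℤ.+ b) ∷ (f +P g)

scaleP : ℤ → Poly → Poly
scaleP c = map (c ℤ.*_)

_*P_ : Poly → Poly → Poly
[]      *P g = []
(a ∷ f) *P g = scaleP a g +P (+ 0 ∷ (f *P g))

sumP : List Poly → Poly
sumP = foldr _+P_ []

_∣P_ : Poly → Poly → Set
d ∣P f = Σ Poly (λ q → f ≈P (d *P q))

det : (n : ℕ) → (Fin n → Fin n → Poly) → Poly
det zero    M = + 1 ∷ []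
det (suc n) M =
  sumP (map (λ j → scaleP ((- (+ 1)) ℤ.^ toℕ j)
                          (M fz j *P det n (λ i k → M (fs i) (punchIn j k))))
            (allFin (suc n)))

aPoly : ℕ → ℕ → Poly
aPoly p k = map (λ m → legendre p (k ∸ m)) (upTo (suc k))

-- H_p(x) = det [a_{i+j-1}(x)]_{1≤i,j≤p}; with 0-based indices i',j' the entry is a_{i'+j'+1}
H : ℕ → Poly
H p = det p (λ i j → aPoly p (suc (toℕ i ℕ.+ toℕ j)))

x²-1 : Poly
x²-1 = - (+ 1) ∷ + 0 ∷ + 1 ∷ []

module Submission where

-- By the factor theorem for x² - 1 (Polynomials) it suffices that H_p(1) = H_p(-1) = 0.
-- Evaluation commutes with the determinant, and a square integer matrix whose rows
-- all sum to zero is singular (Determinants).  For c = ±1 the sequence aₖ(c) is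
-- p-periodic with zero sum over a period, so every row of the Hankel matrix
-- [a_{i+j+1}(c)] sums to zero (Evaluations).  The number theory behind this:
--   * Σ_{m<p} (m/p) = 0, by double counting solutions of x² ≡ m (QuadraticCharacterSum);
--   * -1 is a square modulo p, via the involution x ↦ ±x⁻¹ on {1, …, (p-1)/2}, whose
--     fixed points are even in number (Involution, SquareRootOfMinusOne);
--   * hence (m/p) = ((p - m)/p), which makes aₖ(1) antisymmetric and aₖ(-1)
--     alternating under k ↦ p - 1 - k.

open import Defs
open import Data.Nat as ℕ using (ℕ; zero; suc; _<_; _≤_; z≤n; s≤s; _∸_; _%_; _/_)
import Data.Nat.Properties as ℕP
open import Data.Integer as ℤ using (ℤ; +_; -_; -[1+_]; ∣_∣; _+_; _*_; _-_)
import Data.Integer.Properties as ℤP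
open import Data.Integer.Tactic.RingSolver using (solve-∀)
import Data.Nat.Tactic.RingSolver as ℕSolver
open import Data.Fin as Fin using (Fin; toℕ; fromℕ<; inject₁; punchIn; punchOut)
  renaming (zero to fzero; suc to fsuc)
import Data.Fin.Properties as FinP
open import Data.List using ([]; _∷_; map; tabulate; applyUpTo; upTo)
open import Data.Product using (∃; _×_; _,_; proj₁; proj₂)
open import Data.Sum using (_⊎_; inj₁; inj₂; [_,_]; reduce)
open import Data.Empty using (⊥-elim)
open import Function using (_∘_)
open import Relation.Nullary using (¬_; Dec; yes; no; ¬?; _×-dec_; _⊎-dec_)
open import Relation.Binary.Definitions using (tri<; tri≈; tri>)
open import Relation.Binary.PropositionalEquality
  using (_≡_; _≢_; refl; sym; trans; cong; cong₂; subst; module ≡-Reasoning)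
open import Data.Nat.DivMod using (m≡m%n+[m/n]*n; [m+kn]%n≡m%n; m%n<n; m<n⇒m%n≡m; %-distribˡ-*; m%n%n≡m%n)
open import Data.Nat.Primality using (Prime; euclidsLemma; prime⇒nonTrivial)
import Data.Nat.Divisibility as ℕ∣
open import Data.Integer.Divisibility.Signed using (_∣_; _∣?_; divides; ∣⇒∣ᵤ; ∣ᵤ⇒∣; ∣-refl; ∣m∣n⇒∣m+n; ∣m∣n⇒∣m-n; ∣m+n∣n⇒∣m; ∣m⇒∣-m; ∣n⇒∣m*n)
open import Data.List.Relation.Unary.Any using (any?)
open import Data.List.Relation.Unary.Any.Properties using (applyUpTo⁺; applyUpTo⁻)
open import Data.Nat.Coprimality using (prime⇒coprime; coprime-Bézout)
open import Data.Nat.GCD using (module Bézout)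
open import Algebra.Properties.CommutativeMonoid.Sum ℤP.+-0-commutativeMonoid
  using (sum; sum-syntax; sum-cong-≗; ∑-distrib-+; ∑-comm; sum-replicate-zero)

self-negative⇒0 : ∀ s → s + s ≡ + 0 → s ≡ + 0
self-negative⇒0 s s+s≡0 = ℤP.*-cancelˡ-≡ (+ 2) s (+ 0) (trans (double s) s+s≡0)
  where
  double : ∀ s → + 2 * s ≡ s + s
  double = solve-∀

even≢odd : ∀ a b → a ℕ.+ a ≢ suc (b ℕ.+ b)
even≢odd zero    b       ()
even≢odd (suc a) zero    eq rewrite ℕP.+-suc a a = ℕP.1+n≢0 (ℕP.suc-injective eq)
even≢odd (suc a) (suc b) eq rewrite ℕP.+-suc a a | ℕP.+-suc b b =
  even≢odd a b (ℕP.suc-injective (ℕP.suc-injective eq))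

even≢oddℤ : ∀ a b → a + a ≢ + 1 + b + b
even≢oddℤ a b eq = ℕP.<⇒≱ (ℕP.n<1+n 1) (ℕ∣.∣⇒≤ (∣⇒∣ᵤ 2∣1))
  where
  rearrange : ∀ a b → + 1 ≡ + 1 + b + b - b - b
  rearrange = solve-∀
  double : ∀ a b → a + a - b - b ≡ (a - b) * + 2
  double = solve-∀
  2∣1 : + 2 ∣ + 1
  2∣1 = divides (a - b) (trans (rearrange a b) (trans (cong (λ z → z - b - b) (sym eq)) (double a b)))

module Polynomials where

  eval : ℤ → Poly → ℤ
  eval c []      = + 0
  eval c (a ∷ f) = a + c * eval c f

  eval-+P : ∀ c f g → eval c (f +P g) ≡ eval c f + eval c g
  eval-+P c []      g       = sym (ℤP.+-identityˡ _)
  eval-+P c (a ∷ f) []      = sym (ℤP.+-identityʳ _)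
  eval-+P c (a ∷ f) (b ∷ g) rewrite eval-+P c f g = rearrange a b c (eval c f) (eval c g)
    where
    rearrange : ∀ a b c x y → (a + b) + c * (x + y) ≡ (a + c * x) + (b + c * y)
    rearrange = solve-∀

  eval-scaleP : ∀ c a g → eval c (scaleP a g) ≡ a * eval c g
  eval-scaleP c a []      = sym (ℤP.*-zeroʳ a)
  eval-scaleP c a (b ∷ g) rewrite eval-scaleP c a g = rearrange a b c (eval c g)
    where
    rearrange : ∀ a b c x → a * b + c * (a * x) ≡ a * (b + c * x)
    rearrange = solve-∀

  eval-*P : ∀ c f g → eval c (f *P g) ≡ eval c f * eval c g
  eval-*P c []      g = refl
  eval-*P c (a ∷ f) g
    rewrite eval-+P c (scaleP a g) (+ 0 ∷ (f *P g)) | eval-scaleP c a g | eval-*P c f g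
    = rearrange a c (eval c f) (eval c g)
    where
    rearrange : ∀ a c x y → a * y + (+ 0 + c * (x * y)) ≡ (a + c * x) * y
    rearrange = solve-∀

  eval-sumP-tabulate : ∀ c {A : Set} (F : A → Poly) {n} (g : Fin n → A) →
                       eval c (sumP (map F (tabulate g))) ≡ ∑[ j < n ] eval c (F (g j))
  eval-sumP-tabulate c F {zero}  g = refl
  eval-sumP-tabulate c F {suc n} g =
    trans (eval-+P c (F (g fzero)) _) (cong (λ s → eval c (F (g fzero)) + s) (eval-sumP-tabulate c F (g ∘ fsuc)))

  coeff-+P : ∀ f g n → coeff (f +P g) n ≡ coeff f n + coeff g n
  coeff-+P []      g       n       = sym (ℤP.+-identityˡ _)
  coeff-+P (a ∷ f) []      zero    = sym (ℤP.+-identityʳ _)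
  coeff-+P (a ∷ f) []      (suc n) = sym (ℤP.+-identityʳ _)
  coeff-+P (a ∷ f) (b ∷ g) zero    = refl
  coeff-+P (a ∷ f) (b ∷ g) (suc n) = coeff-+P f g n

  coeff-scaleP : ∀ a g n → coeff (scaleP a g) n ≡ a * coeff g n
  coeff-scaleP a []      n       = sym (ℤP.*-zeroʳ a)
  coeff-scaleP a (b ∷ g) zero    = refl
  coeff-scaleP a (b ∷ g) (suc n) = coeff-scaleP a g n

  coeff-cons-*P : ∀ a f g n → coeff ((a ∷ f) *P g) n ≡ a * coeff g n + coeff (+ 0 ∷ (f *P g)) n
  coeff-cons-*P a f g n = trans (coeff-+P (scaleP a g) _ n) (cong (_+ _) (coeff-scaleP a g n))

  coeff-x²-1-*P : ∀ q n → coeff (x²-1 *P q) n ≡ coeff (+ 0 ∷ + 0 ∷ q) n - coeff q n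
  coeff-x²-1-*P q n = begin
    coeff (x²-1 *P q) n                              ≡⟨ coeff-cons-*P (- + 1) (+ 0 ∷ + 1 ∷ []) q n ⟩
    - + 1 * coeff q n + coeff (+ 0 ∷ (x *P q)) n     ≡⟨ cong (_+ coeff (+ 0 ∷ (x *P q)) n) (ℤP.-1*i≡-i (coeff q n)) ⟩
    - coeff q n + coeff (+ 0 ∷ (x *P q)) n           ≡⟨ cong (λ s → - coeff q n + s) (shifted n) ⟩
    - coeff q n + coeff (+ 0 ∷ + 0 ∷ q) n            ≡⟨ ℤP.+-comm (- coeff q n) _ ⟩
    coeff (+ 0 ∷ + 0 ∷ q) n - coeff q n              ∎
    where
    open ≡-Reasoning
    x : Poly
    x = + 0 ∷ + 1 ∷ []
    unit : ∀ m → coeff ((+ 1 ∷ []) *P q) m ≡ coeff q m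
    unit m rewrite coeff-cons-*P (+ 1) [] q m | ℤP.*-identityˡ (coeff q m) with m
    ... | zero  = ℤP.+-identityʳ _
    ... | suc _ = ℤP.+-identityʳ _
    shifted : ∀ m → coeff (+ 0 ∷ (x *P q)) m ≡ coeff (+ 0 ∷ + 0 ∷ q) m
    shifted zero          = refl
    shifted (suc zero)    = trans (coeff-cons-*P (+ 0) (+ 1 ∷ []) q 0) (ℤP.*-zeroˡ (coeff q 0))
    shifted (suc (suc m)) =
      trans (coeff-cons-*P (+ 0) (+ 1 ∷ []) q (suc m))
            (trans (cong (_+ coeff ((+ 1 ∷ []) *P q) m) (ℤP.*-zeroˡ (coeff q (suc m))))
                   (trans (ℤP.+-identityˡ _) (unit m)))

  -- Division with remainder by x² - 1, computed from the top coefficient down: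
  -- if g = (x² - 1) q + a + b x then c + x g = (x² - 1)(b + x q) + (c + b) + a x.
  record DivisionByX²-1 (f : Poly) : Set where
    field
      quotient : Poly
      r₀ r₁    : ℤ
      coeff-eq : ∀ n → coeff f n ≡ coeff (+ 0 ∷ + 0 ∷ quotient) n - coeff quotient n
                                   + coeff (r₀ ∷ r₁ ∷ []) n
      eval-eq  : ∀ c → eval c f ≡ (c * c - + 1) * eval c quotient + (r₀ + r₁ * c)

  divideByX²-1 : ∀ f → DivisionByX²-1 f
  divideByX²-1 [] = record
    { quotient = [] ; r₀ = + 0 ; r₁ = + 0
    ; coeff-eq = λ { zero → refl ; (suc zero) → refl ; (suc (suc n)) → refl }
    ; eval-eq  = zero-polynomial }
    where
    zero-polynomial : ∀ c → + 0 ≡ (c * c - + 1) * + 0 + (+ 0 + + 0 * c)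
    zero-polynomial = solve-∀
  divideByX²-1 (c ∷ g) = record
    { quotient = r₁ ∷ quotient ; r₀ = c + r₁ ; r₁ = r₀
    ; coeff-eq = coeffs
    ; eval-eq  = values }
    where
    open DivisionByX²-1 (divideByX²-1 g)
    coeffs : ∀ n → coeff (c ∷ g) n ≡ coeff (+ 0 ∷ + 0 ∷ r₁ ∷ quotient) n - coeff (r₁ ∷ quotient) n
                                     + coeff (c + r₁ ∷ r₀ ∷ []) n
    coeffs zero                = constant c r₁
      where
      constant : ∀ c b → c ≡ + 0 - b + (c + b)
      constant = solve-∀
    coeffs (suc zero)          = coeff-eq 0
    coeffs (suc (suc zero))    = trans (coeff-eq 1) (swap (coeff quotient 1) r₁)
      where
      swap : ∀ y b → + 0 - y + b ≡ b - y + + 0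
      swap = solve-∀
    coeffs (suc (suc (suc n))) = coeff-eq (suc (suc n))
    values : ∀ x → eval x (c ∷ g) ≡ (x * x - + 1) * eval x (r₁ ∷ quotient) + ((c + r₁) + r₀ * x)
    values x rewrite eval-eq x = horner x c r₀ r₁ (eval x quotient)
      where
      horner : ∀ x c a b Q → c + x * ((x * x - + 1) * Q + (a + b * x))
                           ≡ (x * x - + 1) * (b + x * Q) + ((c + b) + a * x)
      horner = solve-∀

  x²-1∣P-of-roots : ∀ f → eval (+ 1) f ≡ + 0 → eval (- + 1) f ≡ + 0 → x²-1 ∣P f
  x²-1∣P-of-roots f f[1]≡0 f[-1]≡0 = quotient , coeffs
    where
    open DivisionByX²-1 (divideByX²-1 f)
    -- At x = ±1 the factor x² - 1 vanishes, so f(±1) = r₀ ± r₁.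
    r₀+r₁≡0 : r₀ + r₁ ≡ + 0
    r₀+r₁≡0 = trans (at1 (eval (+ 1) quotient) r₀ r₁) (trans (sym (eval-eq (+ 1))) f[1]≡0)
      where
      at1 : ∀ Q a b → a + b ≡ (+ 1 * + 1 - + 1) * Q + (a + b * + 1)
      at1 = solve-∀
    r₀-r₁≡0 : r₀ - r₁ ≡ + 0
    r₀-r₁≡0 = trans (at-1 (eval (- + 1) quotient) r₀ r₁) (trans (sym (eval-eq (- + 1))) f[-1]≡0)
      where
      at-1 : ∀ Q a b → a - b ≡ (- + 1 * - + 1 - + 1) * Q + (a + b * - + 1)
      at-1 = solve-∀
    r₀≡0 : r₀ ≡ + 0
    r₀≡0 = self-negative⇒0 r₀ (trans (split r₀ r₁) (cong₂ _+_ r₀+r₁≡0 r₀-r₁≡0))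
      where
      split : ∀ a b → a + a ≡ (a + b) + (a - b)
      split = solve-∀
    r₁≡0 : r₁ ≡ + 0
    r₁≡0 = trans (sym (ℤP.+-identityˡ r₁)) (trans (cong (_+ r₁) (sym r₀≡0)) r₀+r₁≡0)
    coeffs : f ≈P (x²-1 *P quotient)
    coeffs n = begin
      coeff f n                                                                       ≡⟨ coeff-eq n ⟩
      coeff (+ 0 ∷ + 0 ∷ quotient) n - coeff quotient n + coeff (r₀ ∷ r₁ ∷ []) n      ≡⟨ cong (λ r → coeff (+ 0 ∷ + 0 ∷ quotient) n - coeff quotient n + r) (no-remainder n) ⟩
      coeff (+ 0 ∷ + 0 ∷ quotient) n - coeff quotient n + + 0                          ≡⟨ ℤP.+-identityʳ _ ⟩
      coeff (+ 0 ∷ + 0 ∷ quotient) n - coeff quotient n                                ≡⟨ coeff-x²-1-*P quotient n ⟨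
      coeff (x²-1 *P quotient) n                                                       ∎
      where
      open ≡-Reasoning
      no-remainder : ∀ n → coeff (r₀ ∷ r₁ ∷ []) n ≡ + 0
      no-remainder zero          = r₀≡0
      no-remainder (suc zero)    = r₁≡0
      no-remainder (suc (suc n)) = refl

module Sums where

  sum-zero : ∀ {n} (f : Fin n → ℤ) → (∀ j → f j ≡ + 0) → sum f ≡ + 0
  sum-zero {n} f f≡0 = trans (sum-cong-≗ f≡0) (sum-replicate-zero n)

  sumTo : ℕ → (ℕ → ℤ) → ℤ
  sumTo n f = ∑[ i < n ] f (toℕ i)

  sumTo-cong : ∀ n {f g : ℕ → ℤ} → (∀ k → k < n → f k ≡ g k) → sumTo n f ≡ sumTo n g
  sumTo-cong n f≡g = sum-cong-≗ (λ i → f≡g (toℕ i) (FinP.toℕ<n i))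

  sumTo-+ : ∀ n (f g : ℕ → ℤ) → sumTo n (λ k → f k + g k) ≡ sumTo n f + sumTo n g
  sumTo-+ n f g = ∑-distrib-+ {n} (f ∘ toℕ) (g ∘ toℕ)

  sumTo-comm : ∀ m n (f : ℕ → ℕ → ℤ) →
               sumTo m (λ i → sumTo n (λ j → f i j)) ≡ sumTo n (λ j → sumTo m (λ i → f i j))
  sumTo-comm m n f = ∑-comm {m} {n} (λ i j → f (toℕ i) (toℕ j))

  sumTo-zero : ∀ n (f : ℕ → ℤ) → (∀ k → k < n → f k ≡ + 0) → sumTo n f ≡ + 0
  sumTo-zero n f f≡0 = sum-zero (f ∘ toℕ) (λ i → f≡0 (toℕ i) (FinP.toℕ<n i))

  sumTo-one : ∀ n → sumTo n (λ _ → + 1) ≡ + n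
  sumTo-one zero    = refl
  sumTo-one (suc n) = trans (cong (λ z → + 1 + z) (sumTo-one n)) (sym (ℤP.pos-+ 1 n))

  sumTo-snoc : ∀ n (f : ℕ → ℤ) → sumTo (suc n) f ≡ sumTo n f + f n
  sumTo-snoc zero    f = trans (ℤP.+-identityʳ (f 0)) (sym (ℤP.+-identityˡ (f 0)))
  sumTo-snoc (suc n) f = trans (cong (λ z → f 0 + z) (sumTo-snoc n (f ∘ suc))) (sym (ℤP.+-assoc (f 0) _ _))

  sumTo-point : ∀ n (f : ℕ → ℤ) a → a < n → (∀ k → k < n → k ≢ a → f k ≡ + 0) → sumTo n f ≡ f a
  sumTo-point (suc n) f zero    _         others =
    trans (cong (λ z → f 0 + z) (sumTo-zero n (f ∘ suc) (λ k k<n → others (suc k) (s≤s k<n) (λ ())))) (ℤP.+-identityʳ (f 0))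
  sumTo-point (suc n) f (suc a) (s≤s a<n) others =
    trans (cong (_+ sumTo n (f ∘ suc)) (others 0 (s≤s z≤n) (λ ())))
          (trans (ℤP.+-identityˡ _)
                 (sumTo-point n (f ∘ suc) a a<n (λ k k<n k≢a → others (suc k) (s≤s k<n) (k≢a ∘ ℕP.suc-injective))))

  sumTo-reverse : ∀ n (f : ℕ → ℤ) → sumTo (suc n) (λ k → f (n ∸ k)) ≡ sumTo (suc n) f
  sumTo-reverse zero    f = refl
  sumTo-reverse (suc n) f = begin
    f (suc n) + sumTo (suc n) (λ k → f (n ∸ k))  ≡⟨ cong (λ z → f (suc n) + z) (sumTo-reverse n f) ⟩
    f (suc n) + sumTo (suc n) f                  ≡⟨ ℤP.+-comm (f (suc n)) _ ⟩
    sumTo (suc n) f + f (suc n)                  ≡⟨ sumTo-snoc (suc n) f ⟨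
    sumTo (suc (suc n)) f                        ∎
    where open ≡-Reasoning

  sumTo-period-shift : ∀ p (f : ℕ → ℤ) → (∀ k → f (k ℕ.+ p) ≡ f k) →
                       ∀ s → sumTo p (λ j → f (s ℕ.+ j)) ≡ sumTo p f
  sumTo-period-shift zero    f periodic s       = refl
  sumTo-period-shift (suc q) f periodic zero    = refl
  sumTo-period-shift (suc q) f periodic (suc s) = begin
    sumTo (suc q) (λ j → f (suc s ℕ.+ j))  ≡⟨ sumTo-cong (suc q) (λ j _ → cong f (sym (ℕP.+-suc s j))) ⟩
    sumTo (suc q) (g ∘ suc)                ≡⟨ sumTo-snoc q (g ∘ suc) ⟩
    sumTo q (g ∘ suc) + g (suc q)          ≡⟨ cong (λ z → sumTo q (g ∘ suc) + z) wrap ⟩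
    sumTo q (g ∘ suc) + g 0                ≡⟨ ℤP.+-comm _ (g 0) ⟩
    sumTo (suc q) g                        ≡⟨ sumTo-period-shift (suc q) f periodic s ⟩
    sumTo (suc q) f                        ∎
    where
    open ≡-Reasoning
    g : ℕ → ℤ
    g j = f (s ℕ.+ j)
    wrap : g (suc q) ≡ g 0
    wrap = trans (periodic s) (cong f (sym (ℕP.+-identityʳ s)))

  ⟦_⟧ : ∀ {A : Set} → Dec A → ℤ
  ⟦ yes _ ⟧ = + 1
  ⟦ no  _ ⟧ = + 0

  ⟦⟧-yes : ∀ {A : Set} (d : Dec A) → A → ⟦ d ⟧ ≡ + 1
  ⟦⟧-yes (yes _) _ = refl
  ⟦⟧-yes (no ¬a) a = ⊥-elim (¬a a)

  ⟦⟧-no : ∀ {A : Set} (d : Dec A) → ¬ A → ⟦ d ⟧ ≡ + 0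
  ⟦⟧-no (yes a) ¬a = ⊥-elim (¬a a)
  ⟦⟧-no (no _)  _  = refl

module Determinants where
  open Polynomials
  open Sums using (sum-zero)

  Matrix : ℕ → Set
  Matrix n = Fin n → Fin n → ℤ

  sgn : ℕ → ℤ
  sgn k = (- + 1) ℤ.^ k

  minor : ∀ {n} → Matrix (suc n) → Fin (suc n) → Matrix n
  minor M j i k = M (fsuc i) (punchIn j k)

  detℤ : ∀ n → Matrix n → ℤ
  detℤ zero    M = + 1
  detℤ (suc n) M = ∑[ j < suc n ] (sgn (toℕ j) * (M fzero j * detℤ n (minor M j)))

  term : ∀ {n} → Matrix (suc n) → Fin (suc n) → ℤ
  term {n} M j = sgn (toℕ j) * (M fzero j * detℤ n (minor M j))

  eval-det : ∀ c n M → eval c (det n M) ≡ detℤ n (λ i j → eval c (M i j))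
  eval-det c zero    M = cong (λ z → + 1 + z) (ℤP.*-zeroʳ c)
  eval-det c (suc n) M = trans (eval-sumP-tabulate c entry (λ j → j)) (sum-cong-≗ eval-entry)
    where
    entry : Fin (suc n) → Poly
    entry j = scaleP (sgn (toℕ j)) (M fzero j *P det n (λ i k → M (fsuc i) (punchIn j k)))
    eval-entry : ∀ j → eval c (entry j)
                     ≡ sgn (toℕ j) * (eval c (M fzero j) * detℤ n (minor (λ i k → eval c (M i k)) j))
    eval-entry j = begin
      eval c (entry j)                             ≡⟨ eval-scaleP c (sgn (toℕ j)) (M fzero j *P det n Mⱼ) ⟩
      sgn (toℕ j) * eval c (M fzero j *P det n Mⱼ)  ≡⟨ cong (sgn (toℕ j) *_) (eval-*P c (M fzero j) (det n Mⱼ)) ⟩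
      sgn (toℕ j) * (eval c (M fzero j) * eval c (det n Mⱼ))
        ≡⟨ cong (λ d → sgn (toℕ j) * (eval c (M fzero j) * d)) (eval-det c n Mⱼ) ⟩
      sgn (toℕ j) * (eval c (M fzero j) * detℤ n (minor (λ i k → eval c (M i k)) j)) ∎
      where
      open ≡-Reasoning
      Mⱼ : Fin n → Fin n → Poly
      Mⱼ i k = M (fsuc i) (punchIn j k)

  detℤ-cong : ∀ n {M N : Matrix n} → (∀ i k → M i k ≡ N i k) → detℤ n M ≡ detℤ n N
  detℤ-cong zero    M≡N = refl
  detℤ-cong (suc n) M≡N = sum-cong-≗ λ j →
    cong₂ (λ a d → sgn (toℕ j) * (a * d)) (M≡N fzero j) (detℤ-cong n (λ i k → M≡N (fsuc i) (punchIn j k)))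

  punchIn≢ : ∀ {n} {j c : Fin (suc n)} (j≢c : j ≢ c) {k : Fin n} → k ≢ punchOut j≢c → punchIn j k ≢ c
  punchIn≢ {j = j} j≢c k≢ eq = k≢ (trans (sym (FinP.punchOut-punchIn j)) (FinP.punchOut-cong j eq))

  det-linear : ∀ n (P M N : Matrix n) (c : Fin n) →
               (∀ i k → k ≢ c → P i k ≡ M i k) → (∀ i k → k ≢ c → P i k ≡ N i k) →
               (∀ i → P i c ≡ M i c + N i c) → detℤ n P ≡ detℤ n M + detℤ n N
  det-linear (suc n) P M N c P≈M P≈N Pc = trans (sum-cong-≗ term-linear) (∑-distrib-+ (term M) (term N))
    where
    term-linear : ∀ j → term P j ≡ term M j + term N j
    term-linear j with j FinP.≟ c
    ... | yes refl = split-entry (sgn (toℕ j)) (M fzero j) (N fzero j)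
                                 (Pc fzero) (same-minor M P≈M) (same-minor N P≈N)
      where
      same-minor : ∀ Q → (∀ i k → k ≢ c → P i k ≡ Q i k) → detℤ n (minor P j) ≡ detℤ n (minor Q j)
      same-minor Q P≈Q = detℤ-cong n (λ i k → P≈Q (fsuc i) (punchIn j k) (FinP.punchInᵢ≢i j k))
      split-entry : ∀ s a b {x d dM dN} → x ≡ a + b → d ≡ dM → d ≡ dN →
                    s * (x * d) ≡ s * (a * dM) + s * (b * dN)
      split-entry s a b {d = d} refl refl refl = distrib s a b d
        where
        distrib : ∀ s a b d → s * ((a + b) * d) ≡ s * (a * d) + s * (b * d)
        distrib = solve-∀
    ... | no j≢c = split-minor (sgn (toℕ j)) (P≈M fzero j j≢c) (P≈N fzero j j≢c) minor-linear
      where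
      c′ : Fin n
      c′ = punchOut j≢c
      column-c : ∀ Q i → Q (fsuc i) (punchIn j c′) ≡ Q (fsuc i) c
      column-c Q i = cong (Q (fsuc i)) (FinP.punchIn-punchOut j≢c)
      minor-linear : detℤ n (minor P j) ≡ detℤ n (minor M j) + detℤ n (minor N j)
      minor-linear = det-linear n (minor P j) (minor M j) (minor N j) c′
        (λ i k k≢c′ → P≈M (fsuc i) (punchIn j k) (punchIn≢ j≢c k≢c′))
        (λ i k k≢c′ → P≈N (fsuc i) (punchIn j k) (punchIn≢ j≢c k≢c′))
        (λ i → trans (column-c P i) (trans (Pc (fsuc i)) (sym (cong₂ _+_ (column-c M i) (column-c N i)))))
      split-minor : ∀ s {x a b d dM dN} → x ≡ a → x ≡ b → d ≡ dM + dN →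
                    s * (x * d) ≡ s * (a * dM) + s * (b * dN)
      split-minor s {x} {dM = dM} {dN} refl refl refl = distrib s x dM dN
        where
        distrib : ∀ s a x y → s * (a * (x + y)) ≡ s * (a * x) + s * (a * y)
        distrib = solve-∀

  det-zero-column : ∀ n (M : Matrix n) (c : Fin n) → (∀ i → M i c ≡ + 0) → detℤ n M ≡ + 0
  det-zero-column n M c Mc≡0 = cancel (det-linear n M M M c (λ _ _ _ → refl) (λ _ _ _ → refl)
                                        (λ i → trans (Mc≡0 i) (sym (cong₂ _+_ (Mc≡0 i) (Mc≡0 i)))))
    where
    cancel : ∀ {d} → d ≡ d + d → d ≡ + 0
    cancel {d} d≡2d = trans (subtract d) (trans (cong (_- d) (sym d≡2d)) (ℤP.+-inverseʳ d))
      where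
      subtract : ∀ d → d ≡ d + d - d
      subtract = solve-∀

  sum-cancelling-pair : ∀ {n} (f : Fin (suc n) → ℤ) (c : Fin n) →
                        (∀ j → j ≢ inject₁ c → j ≢ fsuc c → f j ≡ + 0) →
                        f (inject₁ c) + f (fsuc c) ≡ + 0 → sum f ≡ + 0
  sum-cancelling-pair {suc n} f fzero    others pair =
    trans (cong (λ s → f fzero + (f (fsuc fzero) + s)) rest≡0) (trans (drop-zero (f fzero) (f (fsuc fzero))) pair)
    where
    drop-zero : ∀ a b → a + (b + + 0) ≡ a + b
    drop-zero = solve-∀
    rest≡0 : sum (f ∘ fsuc ∘ fsuc) ≡ + 0
    rest≡0 = sum-zero (f ∘ fsuc ∘ fsuc) (λ j → others (fsuc (fsuc j)) (λ ()) (λ ()))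
  sum-cancelling-pair {suc n} f (fsuc c) others pair =
    trans (cong (_+ sum (f ∘ fsuc)) (others fzero (λ ()) (λ ())))
          (trans (ℤP.+-identityˡ _)
                 (sum-cancelling-pair (f ∘ fsuc) c
                   (λ j j≢c j≢c+1 → others (fsuc j) (j≢c ∘ FinP.suc-injective) (j≢c+1 ∘ FinP.suc-injective))
                   pair))

  punchIn-adjacent : ∀ {n} (j : Fin (suc (suc n))) (c : Fin (suc n)) → j ≢ inject₁ c → j ≢ fsuc c →
                     ∃ λ c′ → punchIn j (inject₁ c′) ≡ inject₁ c × punchIn j (fsuc c′) ≡ fsuc c
  punchIn-adjacent fzero           fzero    j≢c _      = ⊥-elim (j≢c refl)
  punchIn-adjacent fzero           (fsuc c) _   _      = c , refl , refl
  punchIn-adjacent (fsuc fzero)    fzero    _   j≢c+1  = ⊥-elim (j≢c+1 refl)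
  punchIn-adjacent {suc n} (fsuc (fsuc j)) fzero _ _   = fzero , refl , refl
  punchIn-adjacent {suc n} (fsuc j) (fsuc c) j≢c j≢c+1
    with punchIn-adjacent j c (j≢c ∘ cong fsuc) (j≢c+1 ∘ cong fsuc)
  ... | c′ , at-c , at-c+1 = fsuc c′ , cong fsuc at-c , cong fsuc at-c+1

  punchIn-swap : ∀ {n} (c k : Fin n) →
                 punchIn (inject₁ c) k ≡ punchIn (fsuc c) k ⊎
                 (punchIn (inject₁ c) k ≡ fsuc c × punchIn (fsuc c) k ≡ inject₁ c)
  punchIn-swap fzero    fzero    = inj₂ (refl , refl)
  punchIn-swap fzero    (fsuc k) = inj₁ refl
  punchIn-swap (fsuc c) fzero    = inj₁ refl
  punchIn-swap (fsuc c) (fsuc k) with punchIn-swap c k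
  ... | inj₁ same           = inj₁ (cong fsuc same)
  ... | inj₂ (swap₁ , swap₂) = inj₂ (cong fsuc swap₁ , cong fsuc swap₂)

  -- Terms of the expansion away from the two columns vanish by induction; the two
  -- remaining terms have equal minors and opposite signs.
  det-equal-adjacent-columns : ∀ n (M : Matrix (suc n)) (c : Fin n) →
                               (∀ i → M i (inject₁ c) ≡ M i (fsuc c)) → detℤ (suc n) M ≡ + 0
  det-equal-adjacent-columns (suc m) M c Mc≡Mc+1 = sum-cancelling-pair (term M) c other-terms pair
    where
    other-terms : ∀ j → j ≢ inject₁ c → j ≢ fsuc c → term M j ≡ + 0
    other-terms j j≢c j≢c+1 with punchIn-adjacent j c j≢c j≢c+1
    ... | c′ , at-c , at-c+1 =
      trans (cong (λ d → sgn (toℕ j) * (M fzero j * d)) minor≡0)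
            (trans (cong (sgn (toℕ j) *_) (ℤP.*-zeroʳ (M fzero j))) (ℤP.*-zeroʳ (sgn (toℕ j))))
      where
      minor≡0 : detℤ (suc m) (minor M j) ≡ + 0
      minor≡0 = det-equal-adjacent-columns m (minor M j) c′
        (λ i → trans (cong (M (fsuc i)) at-c) (trans (Mc≡Mc+1 (fsuc i)) (sym (cong (M (fsuc i)) at-c+1))))
    same-minors : ∀ i k → minor M (inject₁ c) i k ≡ minor M (fsuc c) i k
    same-minors i k with punchIn-swap c k
    ... | inj₁ same             = cong (M (fsuc i)) same
    ... | inj₂ (swap₁ , swap₂) =
      trans (cong (M (fsuc i)) swap₁) (trans (sym (Mc≡Mc+1 (fsuc i))) (sym (cong (M (fsuc i)) swap₂)))
    pair : term M (inject₁ c) + term M (fsuc c) ≡ + 0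
    pair rewrite FinP.toℕ-inject₁ c | Mc≡Mc+1 fzero | detℤ-cong (suc m) same-minors =
      opposite-signs (sgn (toℕ c)) (M fzero (fsuc c)) (detℤ (suc m) (minor M (fsuc c)))
      where
      opposite-signs : ∀ s a d → s * (a * d) + (- + 1) * s * (a * d) ≡ + 0
      opposite-signs = solve-∀

  det-add-next-column : ∀ n (M P : Matrix (suc n)) (c : Fin n) →
                        (∀ i k → k ≢ inject₁ c → P i k ≡ M i k) →
                        (∀ i → P i (inject₁ c) ≡ M i (inject₁ c) + M i (fsuc c)) →
                        detℤ (suc n) P ≡ detℤ (suc n) M
  det-add-next-column n M P c P≈M Pc =
    trans (det-linear (suc n) P M N (inject₁ c) P≈M P≈N (λ i → trans (Pc i) (cong (λ x → M i (inject₁ c) + x) (sym (N-at-c i)))))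
          (trans (cong (λ x → detℤ (suc n) M + x) N≡0) (ℤP.+-identityʳ _))
    where
    N : Matrix (suc n)
    N i k with k FinP.≟ inject₁ c
    ... | yes _ = M i (fsuc c)
    ... | no  _ = M i k
    N-off-c : ∀ i k → k ≢ inject₁ c → N i k ≡ M i k
    N-off-c i k k≢c with k FinP.≟ inject₁ c
    ... | yes k≡c = ⊥-elim (k≢c k≡c)
    ... | no  _   = refl
    N-at-c : ∀ i → N i (inject₁ c) ≡ M i (fsuc c)
    N-at-c i with inject₁ c FinP.≟ inject₁ c
    ... | yes _    = refl
    ... | no  c≢c  = ⊥-elim (c≢c refl)
    P≈N : ∀ i k → k ≢ inject₁ c → P i k ≡ N i k
    P≈N i k k≢c = trans (P≈M i k k≢c) (sym (N-off-c i k k≢c))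
    c+1≢c : fsuc c ≢ inject₁ c
    c+1≢c eq = ℕP.1+n≢n (trans (cong toℕ eq) (FinP.toℕ-inject₁ c))
    N≡0 : detℤ (suc n) N ≡ + 0
    N≡0 = det-equal-adjacent-columns n N c
      (λ i → trans (N-at-c i) (sym (N-off-c i (fsuc c) c+1≢c)))

  suffix-sum : ∀ {n} → (Fin n → ℤ) → Fin n → ℤ
  suffix-sum v fzero    = sum v
  suffix-sum v (fsuc k) = suffix-sum (v ∘ fsuc) k

  suffix-sum-step : ∀ {n} (v : Fin (suc n) → ℤ) (c : Fin n) →
                    suffix-sum v (inject₁ c) ≡ v (inject₁ c) + suffix-sum v (fsuc c)
  suffix-sum-step v fzero    = refl
  suffix-sum-step v (fsuc c) = suffix-sum-step (v ∘ fsuc) c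

  suffix-sum-last : ∀ {n} (v : Fin (suc n) → ℤ) → suffix-sum v (Fin.fromℕ n) ≡ v (Fin.fromℕ n)
  suffix-sum-last {zero}  v = ℤP.+-identityʳ _
  suffix-sum-last {suc n} v = suffix-sum-last (v ∘ fsuc)

  accumulate : ∀ {n} → Matrix (suc n) → ℕ → Matrix (suc n)
  accumulate M t i k with toℕ k ℕ.<? t
  ... | yes _ = M i k
  ... | no  _ = suffix-sum (M i) k

  accumulate-below : ∀ {n} (M : Matrix (suc n)) {t} i k → toℕ k < t → accumulate M t i k ≡ M i k
  accumulate-below M {t} i k k<t with toℕ k ℕ.<? t
  ... | yes _   = refl
  ... | no  k≮t = ⊥-elim (k≮t k<t)

  accumulate-above : ∀ {n} (M : Matrix (suc n)) {t} i k → ¬ toℕ k < t →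
                     accumulate M t i k ≡ suffix-sum (M i) k
  accumulate-above M {t} i k k≮t with toℕ k ℕ.<? t
  ... | yes k<t = ⊥-elim (k≮t k<t)
  ... | no  _   = refl

  -- Accumulating one more column is the column operation "add column c + 1 to c".
  accumulate-step : ∀ n (M : Matrix (suc n)) (c : Fin n) →
                    detℤ (suc n) (accumulate M (toℕ c)) ≡ detℤ (suc n) (accumulate M (suc (toℕ c)))
  accumulate-step n M c = det-add-next-column n (accumulate M (suc t)) (accumulate M t) c unchanged added
    where
    t : ℕ
    t = toℕ c
    c-at-t : toℕ (inject₁ c) ≡ t
    c-at-t = FinP.toℕ-inject₁ c
    unchanged : ∀ i k → k ≢ inject₁ c → accumulate M t i k ≡ accumulate M (suc t) i k
    unchanged i k k≢c with ℕP.<-cmp (toℕ k) t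
    ... | tri< k<t _ _ = trans (accumulate-below M i k k<t) (sym (accumulate-below M i k (ℕP.m<n⇒m<1+n k<t)))
    ... | tri≈ _ k≡t _ = ⊥-elim (k≢c (FinP.toℕ-injective (trans k≡t (sym c-at-t))))
    ... | tri> _ _ t<k = trans (accumulate-above M i k (ℕP.<-asym t<k))
                               (sym (accumulate-above M i k (λ k<1+t → ℕP.<-irrefl refl (ℕP.<-≤-trans t<k (ℕP.≤-pred k<1+t)))))
    added : ∀ i → accumulate M t i (inject₁ c)
                ≡ accumulate M (suc t) i (inject₁ c) + accumulate M (suc t) i (fsuc c)
    added i = begin
      accumulate M t i (inject₁ c)                  ≡⟨ accumulate-above M i (inject₁ c) (ℕP.<-irrefl c-at-t) ⟩
      suffix-sum (M i) (inject₁ c)                  ≡⟨ suffix-sum-step (M i) c ⟩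
      M i (inject₁ c) + suffix-sum (M i) (fsuc c)
        ≡⟨ cong₂ _+_ (accumulate-below M i (inject₁ c) (ℕP.≤-reflexive (cong suc c-at-t)))
                     (accumulate-above M i (fsuc c) (ℕP.<-irrefl refl)) ⟨
      accumulate M (suc t) i (inject₁ c) + accumulate M (suc t) i (fsuc c) ∎
      where open ≡-Reasoning

  accumulate-chain : ∀ n (M : Matrix (suc n)) t → t ≤ n →
                     detℤ (suc n) (accumulate M 0) ≡ detℤ (suc n) (accumulate M t)
  accumulate-chain n M zero    _     = refl
  accumulate-chain n M (suc t) 1+t≤n =
    trans (accumulate-chain n M t (ℕP.<⇒≤ 1+t≤n))
          (subst (λ s → detℤ (suc n) (accumulate M s) ≡ detℤ (suc n) (accumulate M (suc s)))
                 (FinP.toℕ-fromℕ< 1+t≤n) (accumulate-step n M (fromℕ< 1+t≤n)))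

  -- If every row of a square matrix sums to zero, its determinant vanishes: after
  -- the column operations above, column 0 holds the row sums.
  det-zero-row-sums : ∀ n (M : Matrix (suc n)) → (∀ i → sum (M i) ≡ + 0) → detℤ (suc n) M ≡ + 0
  det-zero-row-sums n M rows≡0 = begin
    detℤ (suc n) M                 ≡⟨ detℤ-cong (suc n) fully-accumulated ⟨
    detℤ (suc n) (accumulate M n)  ≡⟨ accumulate-chain n M n ℕP.≤-refl ⟨
    detℤ (suc n) (accumulate M 0)  ≡⟨ det-zero-column (suc n) (accumulate M 0) fzero
                                        (λ i → trans (accumulate-above M {0} i fzero (λ ())) (rows≡0 i)) ⟩
    + 0                            ∎
    where
    open ≡-Reasoning
    fully-accumulated : ∀ i k → accumulate M n i k ≡ M i k
    fully-accumulated i k with toℕ k ℕ.<? n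
    ... | yes _   = refl
    ... | no  k≮n = trans (cong (suffix-sum (M i)) k≡last) (trans (suffix-sum-last (M i)) (cong (M i) (sym k≡last)))
      where
      k≡last : k ≡ Fin.fromℕ n
      k≡last = FinP.toℕ-injective (trans (ℕP.≤-antisym (ℕP.≤-pred (FinP.toℕ<n k)) (ℕP.≮⇒≥ k≮n))
                                         (sym (FinP.toℕ-fromℕ n)))

-- An involution σ of {0, …, n - 1} fixing 0, with n even, fixes some k ≠ 0.
-- Counting: n = #fixed + #{σ k < k} + #{k < σ k}, and σ exchanges the last two
-- sets, so #fixed is even.
module Involution (n : ℕ) (σ : ℕ → ℕ) (σ<n : ∀ k → k < n → σ k < n)
                  (σσ≡id : ∀ k → k < n → σ (σ k) ≡ k) where
  open Sums

  σ-swap : ∀ j k → k < n → j ≡ σ k → k ≡ σ j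
  σ-swap j k k<n refl = sym (σσ≡id k k<n)

  fixed below above : ℤ
  fixed = sumTo n (λ k → ⟦ σ k ℕ.≟ k ⟧)
  below = sumTo n (λ k → ⟦ σ k ℕ.<? k ⟧)
  above = sumTo n (λ k → ⟦ k ℕ.<? σ k ⟧)

  trichotomy : ∀ k → ⟦ σ k ℕ.≟ k ⟧ + ⟦ σ k ℕ.<? k ⟧ + ⟦ k ℕ.<? σ k ⟧ ≡ + 1
  trichotomy k with ℕP.<-cmp (σ k) k
  ... | tri< σk<k σk≢k k≮σk
    rewrite ⟦⟧-no (σ k ℕ.≟ k) σk≢k | ⟦⟧-yes (σ k ℕ.<? k) σk<k | ⟦⟧-no (k ℕ.<? σ k) k≮σk = refl
  ... | tri≈ σk≮k σk≡k k≮σk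
    rewrite ⟦⟧-yes (σ k ℕ.≟ k) σk≡k | ⟦⟧-no (σ k ℕ.<? k) σk≮k | ⟦⟧-no (k ℕ.<? σ k) k≮σk = refl
  ... | tri> σk≮k σk≢k k<σk
    rewrite ⟦⟧-no (σ k ℕ.≟ k) σk≢k | ⟦⟧-no (σ k ℕ.<? k) σk≮k | ⟦⟧-yes (k ℕ.<? σ k) k<σk = refl

  size : + n ≡ fixed + below + above
  size = begin
    + n                                                                    ≡⟨ sumTo-one n ⟨
    sumTo n (λ _ → + 1)                                                    ≡⟨ sumTo-cong n (λ k _ → sym (trichotomy k)) ⟩
    sumTo n (λ k → ⟦ σ k ℕ.≟ k ⟧ + ⟦ σ k ℕ.<? k ⟧ + ⟦ k ℕ.<? σ k ⟧)      ≡⟨ sumTo-+ n (λ k → ⟦ σ k ℕ.≟ k ⟧ + ⟦ σ k ℕ.<? k ⟧) (λ k → ⟦ k ℕ.<? σ k ⟧) ⟩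
    sumTo n (λ k → ⟦ σ k ℕ.≟ k ⟧ + ⟦ σ k ℕ.<? k ⟧) + above                ≡⟨ cong (_+ above) (sumTo-+ n (λ k → ⟦ σ k ℕ.≟ k ⟧) (λ k → ⟦ σ k ℕ.<? k ⟧)) ⟩
    fixed + below + above                                                  ∎
    where open ≡-Reasoning

  -- Both #{k | σ k < k} and #{j | j < σ j} count the pairs (j, k) with j = σ k and j < k.
  pairs : ℕ → ℕ → ℤ
  pairs j k = ⟦ j ℕ.≟ σ k ⟧ * ⟦ j ℕ.<? k ⟧

  pairs-by-k : ∀ k → k < n → sumTo n (λ j → pairs j k) ≡ ⟦ σ k ℕ.<? k ⟧
  pairs-by-k k k<n =
    trans (sumTo-point n (λ j → pairs j k) (σ k) (σ<n k k<n)
             (λ j _ j≢σk → trans (cong (_* ⟦ j ℕ.<? k ⟧) (⟦⟧-no (j ℕ.≟ σ k) j≢σk)) (ℤP.*-zeroˡ ⟦ j ℕ.<? k ⟧)))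
          (trans (cong (_* ⟦ σ k ℕ.<? k ⟧) (⟦⟧-yes (σ k ℕ.≟ σ k) refl)) (ℤP.*-identityˡ _))

  pairs-by-j : ∀ j → j < n → sumTo n (λ k → pairs j k) ≡ ⟦ j ℕ.<? σ j ⟧
  pairs-by-j j j<n =
    trans (sumTo-point n (λ k → pairs j k) (σ j) (σ<n j j<n)
             (λ k k<n k≢σj → trans (cong (_* ⟦ j ℕ.<? k ⟧) (⟦⟧-no (j ℕ.≟ σ k) (k≢σj ∘ σ-swap j k k<n))) (ℤP.*-zeroˡ ⟦ j ℕ.<? k ⟧)))
          (trans (cong (_* ⟦ j ℕ.<? σ j ⟧) (⟦⟧-yes (j ℕ.≟ σ (σ j)) (sym (σσ≡id j j<n)))) (ℤP.*-identityˡ _))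

  below≡above : below ≡ above
  below≡above = begin
    below                                          ≡⟨ sumTo-cong n (λ k k<n → sym (pairs-by-k k k<n)) ⟩
    sumTo n (λ k → sumTo n (λ j → pairs j k))     ≡⟨ sumTo-comm n n (λ k j → pairs j k) ⟩
    sumTo n (λ j → sumTo n (λ k → pairs j k))     ≡⟨ sumTo-cong n pairs-by-j ⟩
    above                                          ∎
    where open ≡-Reasoning

  -- Otherwise 0 would be the only fixed point and n = 1 + 2·below would be odd.
  second-fixed-point : 0 < n → σ 0 ≡ 0 → ∀ r → n ≡ r ℕ.+ r → ∃ λ k → k < n × k ≢ 0 × σ k ≡ k
  second-fixed-point 0<n σ0≡0 r n≡2r
    with ℕP.anyUpTo? (λ k → ¬? (k ℕ.≟ 0) ×-dec (σ k ℕ.≟ k)) n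
  ... | yes (k , k<n , k≢0 , σk≡k) = k , k<n , k≢0 , σk≡k
  ... | no  none                   = ⊥-elim (even≢oddℤ (+ r) below parity)
    where
    fixed≡1 : fixed ≡ + 1
    fixed≡1 = trans (sumTo-point n _ 0 0<n (λ k k<n k≢0 → ⟦⟧-no (σ k ℕ.≟ k) (λ σk≡k → none (k , k<n , k≢0 , σk≡k))))
                    (⟦⟧-yes (σ 0 ℕ.≟ 0) σ0≡0)
    parity : + r + + r ≡ + 1 + below + below
    parity = trans (sym (ℤP.pos-+ r r))
                   (trans (cong +_ (sym n≡2r))
                          (trans size (cong₂ (λ f a → f + below + a) fixed≡1 (sym below≡above))))

-- Arithmetic modulo a prime p, written p = suc q so that `legendre p` unfolds.
module ModPrime (q : ℕ) (prime : Prime (suc q)) where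

  p : ℕ
  p = suc q

  P : ℤ
  P = + p

  L : ℕ → ℤ
  L = legendre p

  1<p : 1 < p
  1<p = ℕ.nonTrivial⇒n>1 p {{prime⇒nonTrivial prime}}

  0<p : 0 < p
  0<p = ℕ.z<s

  ∣-multiple : ∀ k → P ∣ k * P
  ∣-multiple k = divides k refl

  as-ℕ : ∀ {a b k} → + a ≡ + b + + k * P → a ≡ b ℕ.+ k ℕ.* p
  as-ℕ {a} {b} {k} e =
    ℤP.+-injective (trans e (trans (cong (λ z → + b + z) (sym (ℤP.pos-* k p))) (sym (ℤP.pos-+ b (k ℕ.* p)))))

  difference⇒sum : ∀ a b K → a - b ≡ K * P → a ≡ b + K * P
  difference⇒sum a b K e = trans (add-back a b) (cong (λ z → b + z) e)
    where
    add-back : ∀ a b → a ≡ b + (a - b)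
    add-back = solve-∀

  swap-difference : ∀ a b K → a - b ≡ (- K) * P → b - a ≡ K * P
  swap-difference a b K e = trans (negate a b) (trans (cong -_ e) (negate-product K P))
    where
    negate : ∀ a b → b - a ≡ - (a - b)
    negate = solve-∀
    negate-product : ∀ K P → - ((- K) * P) ≡ K * P
    negate-product = solve-∀

  %≡⇒∣ : ∀ {a b} → a % p ≡ b % p → P ∣ + a - + b
  %≡⇒∣ {a} {b} a%p≡b%p = divides (+ (a / p) - + (b / p)) (begin
    + a - + b                                                     ≡⟨ cong₂ _-_ (expand a) (expand b) ⟩
    (+ (a % p) + + (a / p) * P) - (+ (b % p) + + (b / p) * P)     ≡⟨ cong (λ r → (+ (a % p) + + (a / p) * P) - (r + + (b / p) * P)) (cong +_ (sym a%p≡b%p)) ⟩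
    (+ (a % p) + + (a / p) * P) - (+ (a % p) + + (b / p) * P)     ≡⟨ cancel (+ (a % p)) (+ (a / p)) (+ (b / p)) P ⟩
    (+ (a / p) - + (b / p)) * P                                   ∎)
    where
    open ≡-Reasoning
    expand : ∀ n → + n ≡ + (n % p) + + (n / p) * P
    expand n = trans (cong +_ (m≡m%n+[m/n]*n n p)) (trans (ℤP.pos-+ (n % p) _) (cong (λ z → + (n % p) + z) (ℤP.pos-* (n / p) p)))
    cancel : ∀ r x y P → r + x * P - (r + y * P) ≡ (x - y) * P
    cancel = solve-∀

  ∣⇒%≡ : ∀ {a b} → P ∣ + a - + b → a % p ≡ b % p
  ∣⇒%≡ {a} {b} (divides (+ k) a-b≡kP) =
    trans (cong (_% p) (as-ℕ {a} {b} {k} (difference⇒sum (+ a) (+ b) (+ k) a-b≡kP))) ([m+kn]%n≡m%n b k p)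
  ∣⇒%≡ {a} {b} (divides -[1+ k ] a-b≡-kP) =
    sym (trans (cong (_% p) (as-ℕ {b} {a} {suc k} (difference⇒sum (+ b) (+ a) (+ suc k) (swap-difference (+ a) (+ b) (+ suc k) a-b≡-kP))))
               ([m+kn]%n≡m%n a (suc k) p))

  ∣⇒≡ : ∀ {a b} → a < p → b < p → P ∣ + a - + b → a ≡ b
  ∣⇒≡ {a} {b} a<p b<p a≡b = trans (sym (m<n⇒m%n≡m a<p)) (trans (∣⇒%≡ {a} {b} a≡b) (m<n⇒m%n≡m b<p))

  ∤-small : ∀ {a} → 0 < a → a < p → ¬ P ∣ + a
  ∤-small {suc a} _ a<p p∣a = ℕP.<⇒≱ a<p (ℕ∣.∣⇒≤ (∣⇒∣ᵤ p∣a))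

  ∣-product : ∀ {x y} → P ∣ x * y → (P ∣ x) ⊎ (P ∣ y)
  ∣-product {x} {y} p∣xy with euclidsLemma ∣ x ∣ ∣ y ∣ prime (subst (p ℕ∣.∣_) (ℤP.abs-* x y) (∣⇒∣ᵤ p∣xy))
  ... | inj₁ p∣x = inj₁ (∣ᵤ⇒∣ p∣x)
  ... | inj₂ p∣y = inj₂ (∣ᵤ⇒∣ p∣y)

  _²≡_ : ℕ → ℕ → Set
  x ²≡ a = P ∣ + (x ℕ.* x) - + a

  ²≡-reduce : ∀ x {a} → x ²≡ a → (x % p) ²≡ a
  ²≡-reduce x {a} x²≡a =
    subst (P ∣_) (telescope (+ ((x % p) ℕ.* (x % p))) (+ (x ℕ.* x)) (+ a))
          (∣m∣n⇒∣m+n (%≡⇒∣ {(x % p) ℕ.* (x % p)} {x ℕ.* x} (sym (%-distribˡ-* x x p))) x²≡a)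
    where
    telescope : ∀ u v w → u - v + (v - w) ≡ u - w
    telescope = solve-∀

  data LegendreCase (a : ℕ) (value : ℤ) : Set where
    divisible  : P ∣ + a → value ≡ + 0 → LegendreCase a value
    residue    : ¬ (P ∣ + a) → ∀ x → x ²≡ a → value ≡ + 1 → LegendreCase a value
    nonresidue : ¬ (P ∣ + a) → (∀ x → ¬ x ²≡ a) → value ≡ - + 1 → LegendreCase a value

  legendre-cases : ∀ a → LegendreCase a (L a)
  legendre-cases a with p ℕ∣.∣? a
  ... | yes p∣a = divisible (∣ᵤ⇒∣ p∣a) refl
  ... | no  p∤a with any? (λ x → ((x ℕ.* x) % p) ℕ.≟ (a % p)) (upTo p)
  ...   | yes root =
    let x , _ , x²≡a = applyUpTo⁻ (λ x → x) root in residue (p∤a ∘ ∣⇒∣ᵤ) x (%≡⇒∣ {x ℕ.* x} {a} x²≡a) refl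
  ...   | no  no-root = nonresidue (p∤a ∘ ∣⇒∣ᵤ) rootless refl
    where
    rootless : ∀ x → ¬ x ²≡ a
    rootless x x²≡a = no-root (applyUpTo⁺ (λ x → x) (∣⇒%≡ {(x % p) ℕ.* (x % p)} {a} (²≡-reduce x {a} x²≡a)) (m%n<n x p))

  legendre-invariant : ∀ a b → (P ∣ + a → P ∣ + b) → (P ∣ + b → P ∣ + a) →
                       (∀ x → x ²≡ a → ∃ λ y → y ²≡ b) → (∀ x → x ²≡ b → ∃ λ y → y ²≡ a) → L a ≡ L b
  legendre-invariant a b a⇒b b⇒a root-a⇒b root-b⇒a with legendre-cases a | legendre-cases b
  ... | divisible _ La         | divisible _ Lb         = trans La (sym Lb)
  ... | divisible p∣a _        | residue p∤b _ _ _      = ⊥-elim (p∤b (a⇒b p∣a))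
  ... | divisible p∣a _        | nonresidue p∤b _ _     = ⊥-elim (p∤b (a⇒b p∣a))
  ... | residue p∤a _ _ _      | divisible p∣b _        = ⊥-elim (p∤a (b⇒a p∣b))
  ... | residue _ _ _ La       | residue _ _ _ Lb       = trans La (sym Lb)
  ... | residue _ x x²≡a _     | nonresidue _ rootless _ = ⊥-elim (rootless (proj₁ (root-a⇒b x x²≡a)) (proj₂ (root-a⇒b x x²≡a)))
  ... | nonresidue p∤a _ _     | divisible p∣b _        = ⊥-elim (p∤a (b⇒a p∣b))
  ... | nonresidue _ rootless _ | residue _ x x²≡b _    = ⊥-elim (rootless (proj₁ (root-b⇒a x x²≡b)) (proj₂ (root-b⇒a x x²≡b)))
  ... | nonresidue _ _ La      | nonresidue _ _ Lb      = trans La (sym Lb)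

  legendre-periodic : ∀ a → L (a ℕ.+ p) ≡ L a
  legendre-periodic a = legendre-invariant (a ℕ.+ p) a
    (λ p∣a+p → ∣m+n∣n⇒∣m (subst (P ∣_) a+p p∣a+p) ∣-refl)
    (λ p∣a → subst (P ∣_) (sym a+p) (∣m∣n⇒∣m+n p∣a ∣-refl))
    (λ x root → x , subst (P ∣_) (trans (cong (λ z → + (x ℕ.* x) - z + P) a+p) (add-p (+ (x ℕ.* x)) (+ a) P))
                                 (∣m∣n⇒∣m+n root ∣-refl))
    (λ x root → x , subst (P ∣_) (trans (sub-p (+ (x ℕ.* x)) (+ a) P) (cong (λ z → + (x ℕ.* x) - z) (sym a+p)))
                                 (∣m∣n⇒∣m-n root ∣-refl))
    where
    a+p : + (a ℕ.+ p) ≡ + a + P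
    a+p = ℤP.pos-+ a p
    add-p : ∀ X A P → X - (A + P) + P ≡ X - A
    add-p = solve-∀
    sub-p : ∀ X A P → X - A - P ≡ X - (A + P)
    sub-p = solve-∀

  legendre-multiple : ∀ a → P ∣ + a → L a ≡ + 0
  legendre-multiple a p∣a with legendre-cases a
  ... | divisible _ La     = La
  ... | residue p∤a _ _ _  = ⊥-elim (p∤a p∣a)
  ... | nonresidue p∤a _ _ = ⊥-elim (p∤a p∣a)

  legendre-at-0 : L 0 ≡ + 0
  legendre-at-0 = legendre-multiple 0 (divides (+ 0) refl)

  legendre-at-p : L p ≡ + 0
  legendre-at-p = legendre-multiple p (∣-refl {P})

  -- If i² ≡ -1, then (m/p) = (m′/p) for m + m′ = p: x ↦ i x maps square roots
  -- of m to square roots of -m ≡ m′, and vice versa.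
  legendre-reflect : ∀ i → P ∣ + (i ℕ.* i) + + 1 → ∀ m m′ → m ℕ.+ m′ ≡ p → L m ≡ L m′
  legendre-reflect i i²≡-1 m m′ m+m′≡p =
    legendre-invariant m m′ (complement m m′ m+m′≡p) (complement m′ m (trans (ℕP.+-comm m′ m) m+m′≡p))
      (λ x root → i ℕ.* x , rotate m m′ m+m′≡p x root)
      (λ x root → i ℕ.* x , rotate m′ m (trans (ℕP.+-comm m′ m) m+m′≡p) x root)
    where
    sum≡P : ∀ m m′ → m ℕ.+ m′ ≡ p → + m + + m′ ≡ P
    sum≡P m m′ e = trans (sym (ℤP.pos-+ m m′)) (cong +_ e)
    complement : ∀ m m′ → m ℕ.+ m′ ≡ p → P ∣ + m → P ∣ + m′
    complement m m′ e p∣m = subst (P ∣_) (trans (cong (_- + m) (sym (sum≡P m m′ e))) (cancel (+ m) (+ m′)))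
                                  (∣m∣n⇒∣m-n (∣-refl {P}) p∣m)
      where
      cancel : ∀ M M′ → M + M′ - M ≡ M′
      cancel = solve-∀
    -- (i x)² - m′ = x² (i² + 1) - (x² - m) - (m + m′).
    rotate : ∀ m m′ → m ℕ.+ m′ ≡ p → ∀ x → x ²≡ m → (i ℕ.* x) ²≡ m′
    rotate m m′ e x root =
      subst (P ∣_) (identity (+ i) (+ x) (+ m) (+ m′) (ℤP.pos-* x x) (ℤP.pos-* i i)
                      (trans (ℤP.pos-* (i ℕ.* x) (i ℕ.* x)) (cong₂ _*_ (ℤP.pos-* i x) (ℤP.pos-* i x)))
                      (sum≡P m m′ e))
            (∣m∣n⇒∣m-n (∣m∣n⇒∣m-n (∣n⇒∣m*n (+ (x ℕ.* x)) i²≡-1) root) (∣-refl {P}))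
      where
      identity : ∀ I X M M′ {XX II IXIX Q} → XX ≡ X * X → II ≡ I * I → IXIX ≡ (I * X) * (I * X) →
                 M + M′ ≡ Q → XX * (II + + 1) - (XX - M) - Q ≡ IXIX - M′
      identity I X M M′ refl refl refl refl = expand I X M M′
        where
        expand : ∀ I X M M′ → X * X * (I * I + + 1) - (X * X - M) - (M + M′) ≡ I * X * (I * X) - M′
        expand = solve-∀

-- For an odd prime p = 2h + 1, the Legendre symbols of 0, …, p - 1 sum to zero.
-- Double counting the pairs (m, x) with x² ≡ m: each x gives one m, and each m
-- has 1 + (m/p) square roots.
module QuadraticCharacterSum (h : ℕ) (prime : Prime (suc (h ℕ.+ h))) where
  open Sums
  open ModPrime (h ℕ.+ h) prime

  p-odd : ∀ a → a ℕ.+ a ≢ p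
  p-odd a = even≢odd a h

  squares-to : ℕ → ℕ → ℤ
  squares-to m x = ⟦ (x ℕ.* x) % p ℕ.≟ m % p ⟧

  column-sum : ∀ x → sumTo p (λ m → squares-to m x) ≡ + 1
  column-sum x = trans (sumTo-point p (λ m → squares-to m x) m₀ (m%n<n (x ℕ.* x) p) others)
                       (⟦⟧-yes _ (sym (m%n%n≡m%n (x ℕ.* x) p)))
    where
    m₀ : ℕ
    m₀ = (x ℕ.* x) % p
    others : ∀ m → m < p → m ≢ m₀ → squares-to m x ≡ + 0
    others m m<p m≢m₀ = ⟦⟧-no _ (λ m₀≡m → m≢m₀ (sym (trans m₀≡m (m<n⇒m%n≡m m<p))))

  same-square : ∀ x y m → x ²≡ m → y ²≡ m → (P ∣ + x - + y) ⊎ (P ∣ + x + + y)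
  same-square x y m x²≡m y²≡m =
    ∣-product (subst (P ∣_) (factor (+ x) (+ y) (+ m) (ℤP.pos-* x x) (ℤP.pos-* y y)) (∣m∣n⇒∣m-n x²≡m y²≡m))
    where
    factor : ∀ X Y M {XX YY} → XX ≡ X * X → YY ≡ Y * Y → XX - M - (YY - M) ≡ (X - Y) * (X + Y)
    factor X Y M refl refl = difference-of-squares X Y M
      where
      difference-of-squares : ∀ X Y M → X * X - M - (Y * Y - M) ≡ (X - Y) * (X + Y)
      difference-of-squares = solve-∀

  root-of-zero : ∀ x → x < p → x ²≡ 0 → x ≡ 0
  root-of-zero x x<p x²≡0 = ∣⇒≡ x<p 0<p (subst (P ∣_) (sym (ℤP.+-identityʳ (+ x))) p∣x)
    where
    p∣x : P ∣ + x
    p∣x = reduce (∣-product (subst (P ∣_) (trans (ℤP.+-identityʳ _) (ℤP.pos-* x x)) x²≡0))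

  module TwoRoots (m : ℕ) (p∤m : ¬ (P ∣ + m)) (x₁ : ℕ) (x₁<p : x₁ < p) (x₁²≡m : x₁ ²≡ m) where
    -- The second root x₂ = p - x₁, which differs from x₁ as p is odd.
    x₂ : ℕ
    x₂ = p ∸ x₁

    x₁≢0 : x₁ ≢ 0
    x₁≢0 refl = p∤m (subst (P ∣_) (ℤP.neg-involutive (+ m)) (∣m⇒∣-m (subst (P ∣_) (ℤP.+-identityˡ (- + m)) x₁²≡m)))

    x₂+x₁≡p : + x₂ + + x₁ ≡ P
    x₂+x₁≡p = trans (sym (ℤP.pos-+ x₂ x₁)) (cong +_ (ℕP.m∸n+n≡m (ℕP.<⇒≤ x₁<p)))

    x₂<p : x₂ < p
    x₂<p = ℕP.∸-monoʳ-< {p} {x₁} {0} (ℕP.n≢0⇒n>0 x₁≢0) (ℕP.<⇒≤ x₁<p)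

    x₁≢x₂ : x₁ ≢ x₂
    x₁≢x₂ x₁≡x₂ = p-odd x₁ (trans (cong (x₁ ℕ.+_) x₁≡x₂) (ℕP.m+[n∸m]≡n (ℕP.<⇒≤ x₁<p)))

    -- (p - x₁)² = x₁² - (2x₁ - p)·p.
    x₂²≡m : x₂ ²≡ m
    x₂²≡m = subst (P ∣_) (reflect (+ x₂) (+ x₁) (+ m) (ℤP.pos-* x₂ x₂) (ℤP.pos-* x₁ x₁) x₂+x₁≡p)
                  (∣m∣n⇒∣m+n x₁²≡m (∣-multiple (P - + x₁ - + x₁)))
      where
      reflect : ∀ X₂ X₁ M {X₂X₂ X₁X₁ Q} → X₂X₂ ≡ X₂ * X₂ → X₁X₁ ≡ X₁ * X₁ → X₂ + X₁ ≡ Q →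
                X₁X₁ - M + (Q - X₁ - X₁) * Q ≡ X₂X₂ - M
      reflect X₂ X₁ M refl refl refl = expand X₂ X₁ M
        where
        expand : ∀ X₂ X₁ M → X₁ * X₁ - M + (X₂ + X₁ - X₁ - X₁) * (X₂ + X₁) ≡ X₂ * X₂ - M
        expand = solve-∀

    only-roots : ∀ x → x < p → x ²≡ m → x ≡ x₁ ⊎ x ≡ x₂
    only-roots x x<p x²≡m with same-square x x₁ m x²≡m x₁²≡m
    ... | inj₁ p∣x-x₁ = inj₁ (∣⇒≡ x<p x₁<p p∣x-x₁)
    ... | inj₂ p∣x+x₁ = inj₂ (∣⇒≡ x<p x₂<p (subst (P ∣_) (shift (+ x) (+ x₁) (+ x₂) P x₂+x₁≡p) (∣m∣n⇒∣m-n p∣x+x₁ (∣-refl {P}))))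
      where
      shift : ∀ X X₁ X₂ Q → X₂ + X₁ ≡ Q → X + X₁ - Q ≡ X - X₂
      shift X X₁ X₂ _ refl = cancel X X₁ X₂
        where
        cancel : ∀ X X₁ X₂ → X + X₁ - (X₂ + X₁) ≡ X - X₂
        cancel = solve-∀

    squares-to-m : ∀ x → x < p → squares-to m x ≡ ⟦ x ℕ.≟ x₁ ⟧ + ⟦ x ℕ.≟ x₂ ⟧
    squares-to-m x x<p with x ℕ.≟ x₁
    ... | yes refl = trans (⟦⟧-yes _ (∣⇒%≡ {x₁ ℕ.* x₁} {m} x₁²≡m)) (sym (cong (λ z → + 1 + z) (⟦⟧-no (x₁ ℕ.≟ x₂) x₁≢x₂)))
    ... | no x≢x₁ with x ℕ.≟ x₂
    ...   | yes refl = ⟦⟧-yes _ (∣⇒%≡ {x₂ ℕ.* x₂} {m} x₂²≡m)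
    ...   | no x≢x₂  = ⟦⟧-no _ λ x²%p≡m%p → [ x≢x₁ , x≢x₂ ] (only-roots x x<p (%≡⇒∣ {x ℕ.* x} {m} x²%p≡m%p))

    two-roots : sumTo p (λ x → squares-to m x) ≡ + 2
    two-roots = begin
      sumTo p (λ x → squares-to m x)                                ≡⟨ sumTo-cong p squares-to-m ⟩
      sumTo p (λ x → ⟦ x ℕ.≟ x₁ ⟧ + ⟦ x ℕ.≟ x₂ ⟧)                   ≡⟨ sumTo-+ p (λ x → ⟦ x ℕ.≟ x₁ ⟧) (λ x → ⟦ x ℕ.≟ x₂ ⟧) ⟩
      sumTo p (λ x → ⟦ x ℕ.≟ x₁ ⟧) + sumTo p (λ x → ⟦ x ℕ.≟ x₂ ⟧)   ≡⟨ cong₂ _+_ (indicator x₁ x₁<p) (indicator x₂ x₂<p) ⟩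
      + 2                                                           ∎
      where
      open ≡-Reasoning
      indicator : ∀ a → a < p → sumTo p (λ x → ⟦ x ℕ.≟ a ⟧) ≡ + 1
      indicator a a<p = trans (sumTo-point p _ a a<p (λ x _ x≢a → ⟦⟧-no (x ℕ.≟ a) x≢a)) (⟦⟧-yes (a ℕ.≟ a) refl)

  row-sum : ∀ m → m < p → sumTo p (λ x → squares-to m x) ≡ + 1 + L m
  row-sum m m<p with legendre-cases m
  ... | divisible p∣m Lm≡0 =
    trans (subst (λ m → sumTo p (λ x → squares-to m x) ≡ + 1) (sym m≡0) only-zero)
          (sym (cong (λ z → + 1 + z) Lm≡0))
    where
    m≡0 : m ≡ 0
    m≡0 = ∣⇒≡ m<p 0<p (subst (P ∣_) (sym (ℤP.+-identityʳ (+ m))) p∣m)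
    only-zero : sumTo p (λ x → squares-to 0 x) ≡ + 1
    only-zero = trans (sumTo-point p (λ x → squares-to 0 x) 0 0<p
                         (λ x x<p x≢0 → ⟦⟧-no _ λ x²%p≡0 → x≢0 (root-of-zero x x<p (%≡⇒∣ {x ℕ.* x} {0} x²%p≡0))))
                      (⟦⟧-yes ((0 ℕ.* 0) % p ℕ.≟ 0 % p) refl)
  ... | residue p∤m x₀ x₀²≡m Lm≡1 =
    trans (TwoRoots.two-roots m p∤m (x₀ % p) (m%n<n x₀ p) (²≡-reduce x₀ {m} x₀²≡m)) (sym (cong (λ z → + 1 + z) Lm≡1))
  ... | nonresidue p∤m rootless Lm≡-1 =
    trans (sumTo-zero p (λ x → squares-to m x) (λ x _ → ⟦⟧-no _ λ x²%p≡m%p → rootless x (%≡⇒∣ {x ℕ.* x} {m} x²%p≡m%p)))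
          (sym (cong (λ z → + 1 + z) Lm≡-1))

  -- Σ_m (1 + (m/p)) = #{(m, x)} = p.
  legendre-sum : sumTo p L ≡ + 0
  legendre-sum = cancel (sumTo p L) (begin
    + p + sumTo p L                                  ≡⟨ cong (_+ sumTo p L) (sumTo-one p) ⟨
    sumTo p (λ _ → + 1) + sumTo p L                  ≡⟨ sumTo-+ p (λ _ → + 1) L ⟨
    sumTo p (λ m → + 1 + L m)                        ≡⟨ sumTo-cong p (λ m m<p → sym (row-sum m m<p)) ⟩
    sumTo p (λ m → sumTo p (λ x → squares-to m x))   ≡⟨ sumTo-comm p p squares-to ⟩
    sumTo p (λ x → sumTo p (λ m → squares-to m x))   ≡⟨ sumTo-cong p (λ x _ → column-sum x) ⟩
    sumTo p (λ _ → + 1)                              ≡⟨ sumTo-one p ⟩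
    + p                                              ∎)
    where
    open ≡-Reasoning
    cancel : ∀ s → + p + s ≡ + p → s ≡ + 0
    cancel s p+s≡p = trans (add-subtract (+ p) s) (trans (cong (_- + p) p+s≡p) (ℤP.+-inverseʳ (+ p)))
      where
      add-subtract : ∀ a s → s ≡ a + s - a
      add-subtract = solve-∀

-- If p = 4r + 1 is prime, then -1 is a square modulo p.  Pairing each
-- x ∈ {1, …, h}, h = 2r, with the unique y ∈ {1, …, h} such that x y ≡ ±1 is an
-- involution fixing 1, so it fixes another x, and then x² ≡ -1.
module SquareRootOfMinusOne (r : ℕ) (prime : Prime (suc ((r ℕ.+ r) ℕ.+ (r ℕ.+ r)))) where
  open Sums

  h : ℕ
  h = r ℕ.+ r

  open ModPrime (h ℕ.+ h) prime

  h<p : h < p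
  h<p = s≤s (ℕP.m≤m+n h h)

  2h<p : h ℕ.+ h < p
  2h<p = ℕP.n<1+n (h ℕ.+ h)

  0<h : 0 < h
  0<h with h | 1<p
  ... | zero  | s≤s ()
  ... | suc _ | _      = ℕ.z<s

  1+k<p : ∀ {k} → k < h → suc k < p
  1+k<p k<h = ℕP.≤-<-trans k<h h<p

  _≡±1 : ℤ → Set
  a ≡±1 = (P ∣ a - + 1) ⊎ (P ∣ a + + 1)

  ≡±1? : ∀ a → Dec (a ≡±1)
  ≡±1? a = (P ∣? a - + 1) ⊎-dec (P ∣? a + + 1)

  pos-1+* : ∀ m n → + (1 ℕ.+ m ℕ.* n) ≡ + 1 + + m * + n
  pos-1+* m n = trans (ℤP.pos-+ 1 (m ℕ.* n)) (cong (λ z → + 1 + z) (ℤP.pos-* m n))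

  -- Every 0 < x < p has an inverse up to sign modulo p (Bézout's identity).
  inverse : ∀ x → 0 < x → x < p → ∃ λ y → (+ x * + y) ≡±1
  inverse x@(suc _) _ x<p with coprime-Bézout (prime⇒coprime prime x<p)
  ... | Bézout.+- a y 1+yx≡ap = y , inj₂ (divides (+ a) (begin
    + x * + y + + 1        ≡⟨ commute (+ x) (+ y) ⟩
    + 1 + + y * + x        ≡⟨ pos-1+* y x ⟨
    + (1 ℕ.+ y ℕ.* x)      ≡⟨ cong +_ 1+yx≡ap ⟩
    + (a ℕ.* p)            ≡⟨ ℤP.pos-* a p ⟩
    + a * P                ∎))
    where
    open ≡-Reasoning
    commute : ∀ x y → x * y + + 1 ≡ + 1 + y * x
    commute = solve-∀
  ... | Bézout.-+ a y 1+ap≡yx = y , inj₁ (divides (+ a) (begin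
    + x * + y - + 1             ≡⟨ cong (_- + 1) (trans (ℤP.*-comm (+ x) (+ y)) (sym (ℤP.pos-* y x))) ⟩
    + (y ℕ.* x) - + 1           ≡⟨ cong (λ z → + z - + 1) 1+ap≡yx ⟨
    + (1 ℕ.+ a ℕ.* p) - + 1     ≡⟨ cong (_- + 1) (pos-1+* a p) ⟩
    + 1 + + a * P - + 1         ≡⟨ cancel (+ a * P) ⟩
    + a * P                     ∎))
    where
    open ≡-Reasoning
    cancel : ∀ z → + 1 + z - + 1 ≡ z
    cancel = solve-∀

  replace-factor : ∀ x y y′ c → x * y + c + x * (y′ - y) ≡ x * y′ + c
  replace-factor = solve-∀

  ≡±1-mod : ∀ {x y y′} → (+ x * + y) ≡±1 → P ∣ + y′ - + y → (+ x * + y′) ≡±1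
  ≡±1-mod {x} {y} {y′} (inj₁ xy≡1) y′≡y =
    inj₁ (subst (P ∣_) (replace-factor (+ x) (+ y) (+ y′) (- + 1)) (∣m∣n⇒∣m+n xy≡1 (∣n⇒∣m*n (+ x) y′≡y)))
  ≡±1-mod {x} {y} {y′} (inj₂ xy≡-1) y′≡y =
    inj₂ (subst (P ∣_) (replace-factor (+ x) (+ y) (+ y′) (+ 1)) (∣m∣n⇒∣m+n xy≡-1 (∣n⇒∣m*n (+ x) y′≡y)))

  ≡±1-negate : ∀ {x y z} → (+ x * + y) ≡±1 → z ℕ.+ y ≡ p → (+ x * + z) ≡±1
  ≡±1-negate {x} {y} {z} xy≡±1 z+y≡p = flip xy≡±1
    where
    reflect : ∀ c → + x * P - (+ x * + y + c) ≡ + x * + z - c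
    reflect c = trans (cong (λ Q → + x * Q - (+ x * + y + c)) (trans (cong +_ (sym z+y≡p)) (ℤP.pos-+ z y)))
                      (expand (+ x) (+ y) (+ z) c)
      where
      expand : ∀ x y z c → x * (z + y) - (x * y + c) ≡ x * z - c
      expand = solve-∀
    p∣xp : P ∣ + x * P
    p∣xp = ∣n⇒∣m*n (+ x) (∣-refl {P})
    flip : (+ x * + y) ≡±1 → (+ x * + z) ≡±1
    flip (inj₁ xy≡1)  = inj₂ (subst (P ∣_) (reflect (- + 1)) (∣m∣n⇒∣m-n p∣xp xy≡1))
    flip (inj₂ xy≡-1) = inj₁ (subst (P ∣_) (reflect (+ 1)) (∣m∣n⇒∣m-n p∣xp xy≡-1))

  0≢±1 : ¬ (+ 0) ≡±1
  0≢±1 (inj₁ p∣-1) = ∤-small ℕ.z<s 1<p (∣m⇒∣-m p∣-1)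
  0≢±1 (inj₂ p∣1)  = ∤-small ℕ.z<s 1<p p∣1

  reflect-index : ∀ j → h ≤ j → suc j < p → ∃ λ j′ → j′ < h × suc j′ ℕ.+ suc j ≡ p
  reflect-index j h≤j 1+j<p = j′ , j′<h , cong suc j′+1+j≡2h
    where
    j′ : ℕ
    j′ = (h ℕ.+ h) ∸ suc j
    j′+1+j≡2h : j′ ℕ.+ suc j ≡ h ℕ.+ h
    j′+1+j≡2h = ℕP.m∸n+n≡m (ℕP.≤-pred 1+j<p)
    j′<h : j′ < h
    j′<h = ℕP.≰⇒> λ h≤j′ → ℕP.1+n≰n (subst (ℕ._≤ h ℕ.+ h) (ℕP.+-suc h h)
                                        (subst (h ℕ.+ suc h ≤_) j′+1+j≡2h (ℕP.+-mono-≤ h≤j′ (s≤s h≤j))))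

  -- Each x = k + 1 ≤ h has a partner y = j + 1 ≤ h with x y ≡ ±1: reduce an inverse
  -- modulo p, and replace it by p minus it if it exceeds h.
  partner-exists : ∀ k → k < h → ∃ λ j → j < h × (+ suc k * + suc j) ≡±1
  partner-exists k k<h =
    fold (y % p) (m%n<n y p) (≡±1-mod {suc k} {y} {y % p} xy≡±1 (%≡⇒∣ {y % p} {y} (m%n%n≡m%n y p)))
    where
    y : ℕ
    y = proj₁ (inverse (suc k) ℕ.z<s (1+k<p k<h))
    xy≡±1 : (+ suc k * + y) ≡±1
    xy≡±1 = proj₂ (inverse (suc k) ℕ.z<s (1+k<p k<h))
    fold : ∀ z → z < p → (+ suc k * + z) ≡±1 → ∃ λ j → j < h × (+ suc k * + suc j) ≡±1
    fold zero    _     x0≡±1 = ⊥-elim (0≢±1 (subst _≡±1 (ℤP.*-zeroʳ (+ suc k)) x0≡±1))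
    fold (suc j) 1+j<p xz≡±1 with suc j ℕ.≤? h
    ... | yes 1+j≤h = j , 1+j≤h , xz≡±1
    ... | no  1+j≰h =
      let j′ , j′<h , sum≡p = reflect-index j (ℕP.≤-pred (ℕP.≰⇒> 1+j≰h)) 1+j<p
      in  j′ , j′<h , ≡±1-negate {suc k} {suc j} {suc j′} xz≡±1 sum≡p

  -- The partner is unique: x y ≡ ±1 and x y′ ≡ ±1 with y, y′ ≤ h force y = y′,
  -- since p divides neither x nor 0 < y + y′ < p.
  partner-unique : ∀ k j j′ → k < h → j < h → j′ < h →
                   (+ suc k * + suc j) ≡±1 → (+ suc k * + suc j′) ≡±1 → j ≡ j′
  partner-unique k j j′ k<h j<h j′<h = compare
    where
    X Y Y′ : ℤ
    X = + suc k
    Y = + suc j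
    Y′ = + suc j′
    p∤x : ¬ (P ∣ X)
    p∤x = ∤-small ℕ.z<s (1+k<p k<h)
    p∤y+y′ : ¬ (P ∣ Y + Y′)
    p∤y+y′ p∣y+y′ = ∤-small ℕ.z<s (ℕP.≤-<-trans (ℕP.+-mono-≤ j<h j′<h) 2h<p)
                              (subst (P ∣_) (sym (ℤP.pos-+ (suc j) (suc j′))) p∣y+y′)
    same-sign : ∀ c → P ∣ X * Y + c → P ∣ X * Y′ + c → j ≡ j′
    same-sign c d d′ with ∣-product (subst (P ∣_) (difference X Y Y′ c) (∣m∣n⇒∣m-n d d′))
      where
      difference : ∀ X Y Y′ c → X * Y + c - (X * Y′ + c) ≡ X * (Y - Y′)
      difference = solve-∀
    ... | inj₁ p∣x     = ⊥-elim (p∤x p∣x)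
    ... | inj₂ p∣y-y′ = ℕP.suc-injective (∣⇒≡ (1+k<p j<h) (1+k<p j′<h) p∣y-y′)
    opposite-sign : ∀ c → P ∣ X * Y + c → P ∣ X * Y′ - c → j ≡ j′
    opposite-sign c d d′ = ⊥-elim ([ p∤x , p∤y+y′ ] (∣-product (subst (P ∣_) (total X Y Y′ c) (∣m∣n⇒∣m+n d d′))))
      where
      total : ∀ X Y Y′ c → X * Y + c + (X * Y′ - c) ≡ X * (Y + Y′)
      total = solve-∀
    compare : (X * Y) ≡±1 → (X * Y′) ≡±1 → j ≡ j′
    compare (inj₁ d) (inj₁ d′) = same-sign (- + 1) d d′
    compare (inj₂ d) (inj₂ d′) = same-sign (+ 1) d d′
    compare (inj₁ d) (inj₂ d′) = opposite-sign (- + 1) d d′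
    compare (inj₂ d) (inj₁ d′) = opposite-sign (+ 1) d d′

  partner : ℕ → ℕ
  partner k with ℕP.anyUpTo? (λ j → ≡±1? (+ suc k * + suc j)) h
  ... | yes (j , _) = j
  ... | no  _       = 0

  partner-spec : ∀ k → k < h → partner k < h × (+ suc k * + suc (partner k)) ≡±1
  partner-spec k k<h with ℕP.anyUpTo? (λ j → ≡±1? (+ suc k * + suc j)) h
  ... | yes (j , j<h , xy≡±1) = j<h , xy≡±1
  ... | no  none              = ⊥-elim (none (partner-exists k k<h))

  partner<h : ∀ k → k < h → partner k < h
  partner<h k k<h = proj₁ (partner-spec k k<h)

  -- By uniqueness, partner is an involution of {0, …, h - 1} fixing 0 (x = 1).
  partner-involutive : ∀ k → k < h → partner (partner k) ≡ k
  partner-involutive k k<h =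
    sym (partner-unique j k (partner j) j<h k<h (partner<h j j<h)
           (subst _≡±1 (ℤP.*-comm (+ suc k) (+ suc j)) (proj₂ (partner-spec k k<h)))
           (proj₂ (partner-spec j j<h)))
    where
    j : ℕ
    j = partner k
    j<h : j < h
    j<h = partner<h k k<h

  partner-zero : partner 0 ≡ 0
  partner-zero = partner-unique 0 (partner 0) 0 0<h (partner<h 0 0<h) 0<h
                   (proj₂ (partner-spec 0 0<h)) (inj₁ (divides (+ 0) refl))

  -- A partner-fixed x ≠ 1 satisfies x² ≡ ±1, and x² ≡ 1 would force x ≡ ±1.
  sqrt-minus-one : ∃ λ i → P ∣ + (i ℕ.* i) + + 1
  sqrt-minus-one with Involution.second-fixed-point h partner partner<h partner-involutive 0<h partner-zero r refl
  ... | k , k<h , k≢0 , fixed =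
    suc k , square (subst (λ j → (+ suc k * + suc j) ≡±1) fixed (proj₂ (partner-spec k k<h)))
    where
    X : ℤ
    X = + suc k
    square : (X * X) ≡±1 → P ∣ + (suc k ℕ.* suc k) + + 1
    square (inj₂ p∣x²+1) = subst (λ x² → P ∣ x² + + 1) (sym (ℤP.pos-* (suc k) (suc k))) p∣x²+1
    square (inj₁ p∣x²-1) with ∣-product (subst (P ∣_) (factor X) p∣x²-1)
      where
      factor : ∀ X → X * X - + 1 ≡ (X - + 1) * (X + + 1)
      factor = solve-∀
    ... | inj₁ p∣x-1 = ⊥-elim (k≢0 (ℕP.suc-injective (∣⇒≡ (1+k<p k<h) 1<p p∣x-1)))
    ... | inj₂ p∣x+1 = ⊥-elim (∤-small ℕ.z<s (ℕP.≤-<-trans (ℕP.+-mono-≤ k<h 0<h) 2h<p)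
                                        (subst (P ∣_) (sym (ℤP.pos-+ (suc k) 1)) p∣x+1))

module Evaluations (r : ℕ) (prime : Prime (suc ((r ℕ.+ r) ℕ.+ (r ℕ.+ r)))) where
  open Polynomials
  open Determinants
  open Sums

  h : ℕ
  h = r ℕ.+ r
  open ModPrime (h ℕ.+ h) prime
  open QuadraticCharacterSum h prime using (legendre-sum)
  open SquareRootOfMinusOne r prime using (sqrt-minus-one)

  q : ℕ
  q = h ℕ.+ h

  -- a_k(c), by Horner's rule: a₀(c) = (0/p), a_{k+1}(c) = ((k+1)/p) + c a_k(c).
  a : ℤ → ℕ → ℤ
  a c zero    = L 0
  a c (suc k) = L (suc k) + c * a c k

  map-applyUpTo : ∀ (F : ℕ → ℤ) (g : ℕ → ℕ) n → map F (applyUpTo g n) ≡ applyUpTo (F ∘ g) n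
  map-applyUpTo F g zero    = refl
  map-applyUpTo F g (suc n) = cong (F (g 0) ∷_) (map-applyUpTo F (g ∘ suc) n)

  eval-aPoly : ∀ c k → eval c (aPoly p k) ≡ a c k
  eval-aPoly c k = trans (cong (eval c) (map-applyUpTo (λ m → L (k ∸ m)) (λ m → m) (suc k))) (horner k)
    where
    horner : ∀ k → eval c (applyUpTo (λ m → L (k ∸ m)) (suc k)) ≡ a c k
    horner zero    = trans (cong (λ z → L 0 + z) (ℤP.*-zeroʳ c)) (ℤP.+-identityʳ (L 0))
    horner (suc k) = cong (λ z → L (suc k) + c * z) (horner k)

  a-zero : ∀ c → a c 0 ≡ + 0
  a-zero c = legendre-at-0

  -- Once a_p(c) = 0, the sequence a_k(c) is p-periodic, as (k/p) is.
  a-periodic : ∀ c → a c p ≡ + 0 → ∀ k → a c (k ℕ.+ p) ≡ a c k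
  a-periodic c ap≡0 zero    = trans ap≡0 (sym (a-zero c))
  a-periodic c ap≡0 (suc k) = cong₂ (λ l v → l + c * v) (legendre-periodic (suc k)) (a-periodic c ap≡0 k)

  -- If a_k(c) is p-periodic with zero sum over a period, every row of the Hankel
  -- matrix [a_{i+j+1}(c)] sums to zero, so H_p(c) = 0.
  eval-H≡0 : ∀ c → (∀ k → a c (k ℕ.+ p) ≡ a c k) → sumTo p (a c) ≡ + 0 → eval c (H p) ≡ + 0
  eval-H≡0 c periodic period-sum≡0 = begin
    eval c (H p)                                              ≡⟨ eval-det c p (λ i j → aPoly p (suc (toℕ i ℕ.+ toℕ j))) ⟩
    detℤ p (λ i j → eval c (aPoly p (suc (toℕ i ℕ.+ toℕ j)))) ≡⟨ detℤ-cong p (λ i j → eval-aPoly c (suc (toℕ i ℕ.+ toℕ j))) ⟩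
    detℤ p (λ i j → a c (suc (toℕ i ℕ.+ toℕ j)))              ≡⟨ det-zero-row-sums q (λ i j → a c (suc (toℕ i ℕ.+ toℕ j))) row-sum ⟩
    + 0                                                       ∎
    where
    open ≡-Reasoning
    row-sum : ∀ (i : Fin p) → sumTo p (λ j → a c (suc (toℕ i) ℕ.+ j)) ≡ + 0
    row-sum i = trans (sumTo-period-shift p (a c) periodic (suc (toℕ i))) period-sum≡0

  -- Since p ≡ 1 (mod 4), -1 is a square, hence (m/p) = ((p - m)/p).
  reflect : ∀ m m′ → m ℕ.+ m′ ≡ p → L m ≡ L m′
  reflect = legendre-reflect (proj₁ sqrt-minus-one) (proj₂ sqrt-minus-one)

  a-at-1 : ∀ k → a (+ 1) k ≡ sumTo (suc k) L
  a-at-1 zero    = sym (ℤP.+-identityʳ (L 0))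
  a-at-1 (suc k) = begin
    L (suc k) + + 1 * a (+ 1) k   ≡⟨ cong (λ z → L (suc k) + z) (ℤP.*-identityˡ (a (+ 1) k)) ⟩
    L (suc k) + a (+ 1) k         ≡⟨ ℤP.+-comm (L (suc k)) (a (+ 1) k) ⟩
    a (+ 1) k + L (suc k)         ≡⟨ cong (_+ L (suc k)) (a-at-1 k) ⟩
    sumTo (suc k) L + L (suc k)   ≡⟨ sumTo-snoc (suc k) L ⟨
    sumTo (suc (suc k)) L         ∎
    where open ≡-Reasoning

  -- a_{p-1}(1) and a_p(1) are full sums of the symbol, hence zero.
  a-at-1-q : a (+ 1) q ≡ + 0
  a-at-1-q = trans (a-at-1 q) legendre-sum

  a-at-1-p : a (+ 1) p ≡ + 0
  a-at-1-p = trans (a-at-1 p) (trans (sumTo-snoc p L) (cong₂ _+_ legendre-sum legendre-at-p))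

  -- a_k(1) + a_j(1) = 0 whenever k + j = p - 1, by the reflection symmetry.
  a-at-1-antisymmetric : ∀ k j → k ℕ.+ j ≡ q → a (+ 1) k + a (+ 1) j ≡ + 0
  a-at-1-antisymmetric zero    j 0+j≡q = cong₂ _+_ (a-zero (+ 1)) (trans (cong (a (+ 1)) 0+j≡q) a-at-1-q)
  a-at-1-antisymmetric (suc k) j 1+k+j≡q =
    shift (L (suc k)) (L (suc j)) (a (+ 1) k) (a (+ 1) j)
          (reflect (suc k) (suc j) (cong suc k+1+j≡q))
          (a-at-1-antisymmetric k (suc j) k+1+j≡q)
    where
    k+1+j≡q : k ℕ.+ suc j ≡ q
    k+1+j≡q = trans (ℕP.+-suc k j) 1+k+j≡q
    shift : ∀ l l′ x y → l ≡ l′ → x + (l′ + + 1 * y) ≡ + 0 → l + + 1 * x + y ≡ + 0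
    shift l _ x y refl e = trans (regroup l x y) e
      where
      regroup : ∀ l x y → l + + 1 * x + y ≡ x + (l + + 1 * y)
      regroup = solve-∀

  -- Pairing k with p - 1 - k shows that the period sum equals its own negative.
  sum-at-1 : sumTo p (a (+ 1)) ≡ + 0
  sum-at-1 = self-negative⇒0 S (begin
    S + S                                            ≡⟨ cong (_+ S) (sumTo-reverse q (a (+ 1))) ⟨
    sumTo p (λ k → a (+ 1) (q ∸ k)) + S              ≡⟨ sumTo-+ p (λ k → a (+ 1) (q ∸ k)) (a (+ 1)) ⟨
    sumTo p (λ k → a (+ 1) (q ∸ k) + a (+ 1) k)      ≡⟨ sumTo-zero p _ pairs ⟩
    + 0                                              ∎)
    where
    open ≡-Reasoning
    S : ℤ
    S = sumTo p (a (+ 1))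
    pairs : ∀ k → k < p → a (+ 1) (q ∸ k) + a (+ 1) k ≡ + 0
    pairs k k<p = trans (ℤP.+-comm (a (+ 1) (q ∸ k)) (a (+ 1) k))
                        (a-at-1-antisymmetric k (q ∸ k) (ℕP.m+[n∸m]≡n (ℕP.≤-pred k<p)))

  b : ℕ → ℤ
  b = a (- + 1)

  b-reflection : ∀ k j → k ℕ.+ j ≡ q → b k - b j ≡ sgn k * (- b q)
  b-reflection zero j 0+j≡q =
    trans (cong₂ _-_ (a-zero (- + 1)) (cong b 0+j≡q)) (negate (b q))
    where
    negate : ∀ y → + 0 - y ≡ + 1 * (- y)
    negate = solve-∀
  b-reflection (suc k) j 1+k+j≡q =
    shift (L (suc k)) (L (suc j)) (b k) (b j) (sgn k) (- b q)
          (reflect (suc k) (suc j) (cong suc k+1+j≡q))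
          (b-reflection k (suc j) k+1+j≡q)
    where
    k+1+j≡q : k ℕ.+ suc j ≡ q
    k+1+j≡q = trans (ℕP.+-suc k j) 1+k+j≡q
    shift : ∀ l l′ x y s w → l ≡ l′ → x - (l′ + - + 1 * y) ≡ s * w → l + - + 1 * x - y ≡ - + 1 * s * w
    shift l _ x y s w refl e = trans (regroup l x y) (trans (cong (λ z → - + 1 * z) e) (sym (ℤP.*-assoc (- + 1) s w)))
      where
      regroup : ∀ l x y → l + - + 1 * x - y ≡ - + 1 * (x - (l + - + 1 * y))
      regroup = solve-∀

  sgn-even : ∀ n → sgn (n ℕ.+ n) ≡ + 1
  sgn-even zero    = refl
  sgn-even (suc n) rewrite ℕP.+-suc n n | sgn-even n = refl

  -- p - 1 is even, so b_{p-1} = -b_{p-1}.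
  b-q : b q ≡ + 0
  b-q = self-negative⇒0 (b q) (begin
    b q + b q                          ≡⟨ as-difference (b q) ⟩
    b q - + 0 - + 1 * (- b q)          ≡⟨ cong₂ (λ z s → b q - z - s * (- b q)) (a-zero (- + 1)) (sgn-even h) ⟨
    b q - b 0 - sgn q * (- b q)        ≡⟨ cong (λ z → z - sgn q * (- b q)) (b-reflection q 0 (ℕP.+-identityʳ q)) ⟩
    sgn q * (- b q) - sgn q * (- b q)  ≡⟨ ℤP.+-inverseʳ (sgn q * (- b q)) ⟩
    + 0                                ∎)
    where
    open ≡-Reasoning
    as-difference : ∀ v → v + v ≡ v - + 0 - + 1 * (- v)
    as-difference = solve-∀

  -- Hence b_p = (p/p) - b_{p-1} = 0.
  b-p : b p ≡ + 0
  b-p = cong₂ (λ l v → l + - + 1 * v) legendre-at-p b-q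

  -- Consecutive values satisfy b_k + b_{k+1} = ((k+1)/p), so the period sum is
  -- half of Σ_{0 < m < p} (m/p) = 0.
  sum-at-minus-1 : sumTo p b ≡ + 0
  sum-at-minus-1 = self-negative⇒0 S (begin
    S + S                                   ≡⟨ cong₂ _+_ drop-last drop-first ⟩
    sumTo q b + sumTo q (b ∘ suc)           ≡⟨ sumTo-+ q b (b ∘ suc) ⟨
    sumTo q (λ k → b k + b (suc k))         ≡⟨ sumTo-cong q (λ k _ → consecutive (b k) (L (suc k))) ⟩
    sumTo q (L ∘ suc)                       ≡⟨ trans (cong (_+ sumTo q (L ∘ suc)) legendre-at-0) (ℤP.+-identityˡ _) ⟨
    L 0 + sumTo q (L ∘ suc)                 ≡⟨ legendre-sum ⟩
    + 0                                     ∎)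
    where
    open ≡-Reasoning
    S : ℤ
    S = sumTo p b
    drop-last : S ≡ sumTo q b
    drop-last = trans (sumTo-snoc q b) (trans (cong (λ z → sumTo q b + z) b-q) (ℤP.+-identityʳ _))
    drop-first : S ≡ sumTo q (b ∘ suc)
    drop-first = trans (cong (_+ sumTo q (b ∘ suc)) (a-zero (- + 1))) (ℤP.+-identityˡ _)
    consecutive : ∀ x l → x + (l + - + 1 * x) ≡ l
    consecutive = solve-∀

  H-at-1 : eval (+ 1) (H p) ≡ + 0
  H-at-1 = eval-H≡0 (+ 1) (a-periodic (+ 1) a-at-1-p) sum-at-1

  H-at-minus-1 : eval (- + 1) (H p) ≡ + 0
  H-at-minus-1 = eval-H≡0 (- + 1) (a-periodic (- + 1) b-p) sum-at-minus-1

four-r+1 : ∀ p → p % 4 ≡ 1 → p ≡ suc ((p / 4 ℕ.+ p / 4) ℕ.+ (p / 4 ℕ.+ p / 4))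
four-r+1 p p%4≡1 = trans (m≡m%n+[m/n]*n p 4) (trans (cong (ℕ._+ p / 4 ℕ.* 4) p%4≡1) (cong suc (times-four (p / 4))))
  where
  times-four : ∀ r → r ℕ.* 4 ≡ (r ℕ.+ r) ℕ.+ (r ℕ.+ r)
  times-four = ℕSolver.solve-∀

lemma7 : (p : ℕ) → Prime p → p % 4 ≡ 1 → x²-1 ∣P H p
lemma7 p p-prime p%4≡1 =
  subst (λ p → x²-1 ∣P H p) (sym p≡4r+1)
        (Polynomials.x²-1∣P-of-roots (H (suc q)) (Evaluations.H-at-1 r prime′) (Evaluations.H-at-minus-1 r prime′))
  where
  r q : ℕ
  r = p / 4
  q = (r ℕ.+ r) ℕ.+ (r ℕ.+ r)
  p≡4r+1 : p ≡ suc q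
  p≡4r+1 = four-r+1 p p%4≡1
  prime′ : Prime (suc q)
  prime′ = subst Prime p≡4r+1 p-prime
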